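{- Let $f$ and $g$ be functions such that either (0-case) $f\in\mathcal{F}$ and $g\in\mathcal{F}_0$, or (1-case) $f\in\mathbb{K}[x^{ -1},x]$ and $g\in\mathcal{F}_1$, so that $f\circ g\in\mathcal{F}$. Then for every $h\in\mathcal{F}$: $h=f\circ g$ if and only if $\Phi_n(h)=\Phi_n(f)\circ\Phi_{\bullet}(g)$ for all $n\ge0$; that is, $\Phi_n(h)=\Phi_n(f)(\Phi_1(g),\ldots,\Phi_n(g))$ in the 0-case and $\Phi_n(h)=\Phi_n(f)(\Phi_0(g),\Phi_1(g),\ldots,\Phi_n(g))$ in the 1-case.
   Context: $\mathbb{K}$ is a field of characteristic zero, $\mathcal{F}=\mathbb{K}[[x]]$ with derivation $D$ (extended to Laurent polynomials $\mathbb{K}[x^{ -1},x]$), $\mathcal{F}_0$ the series with zero constant term, $\mathcal{F}_1$ those with nonzero constant term; composition $f\circ g=\sum_n([x^n]f)g^n$. Partial Bell polynomials: $B_{0,0}=1$, $B_{n,0}=0$ ($n\ge1$), $B_{n,k}=0$ ($k>n$), and for $1\le k\le n$, $B_{n,k}=\sum\frac{n!}{\prod_ir_i!(i!)^{r_i}}\prod_iX_i^{r_i}$ over non-negative integers with $\sum r_i=k$, $\sum ir_i=n$. Faà di Bruno polynomials: for a power series $u\in\mathcal{F}$, $\Phi_n(u):=\sum_{k=0}^nD^k(u)(0)B_{n,k}$ (so $\Phi_0(u)=u(0)$); for a Laurent polynomial $f$ in the 1-case, $\Phi_n(f):=\sum_{k=0}^nD^k(f)(X_0)B_{n,k}$,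 a polynomial in $X_0^{\pm1},X_1,\ldots,X_n$. $P(H_0,H_1,\ldots)$ denotes substituting $H_j$ for $X_j$. -}

module Defs where

open import Level using (Level; _⊔_) renaming (suc to lsuc)
open import Algebra.Bundles using (CommutativeRing)
open import Data.Nat as ℕ using (ℕ; zero; suc; _∸_; _≡ᵇ_; _≤ᵇ_; NonZero)
open import Data.Nat.Properties using (m*n≢0; _!≢0; m^n≢0)
open import Data.Nat.DivMod using (_/_)
open import Data.Bool using (Bool; true; false; if_then_else_; _∧_)
open import Data.List as List using (List; []; _∷_; concatMap; upTo)
open import Data.Vec as Vec using (Vec; []; _∷_; lookup)
open import Data.Fin using (Fin; toℕ)
open import Data.Product using (_×_)
open import Relation.Nullary using (¬_)

-- The ground field 𝕂: a commutative ring (with setoid equality ≈)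
-- which is a field of characteristic zero.  The field inverse is
-- given as a function, specified on nonzero elements.

module _ {c ℓ : Level} (K : CommutativeRing c ℓ) where
  open CommutativeRing K

  ι : ℕ → Carrier
  ι zero    = 0#
  ι (suc n) = 1# + ι n

  record IsCharZeroField : Set (c ⊔ ℓ) where
    field
      _⁻¹       : Carrier → Carrier
      ⁻¹-inverse : ∀ x → ¬ (x ≈ 0#) → x * (x ⁻¹) ≈ 1#
      1≉0       : ¬ (1# ≈ 0#)
      charZero  : ∀ n → ¬ (ι (suc n) ≈ 0#)

  Σ< : ℕ → (ℕ → Carrier) → Carrier
  Σ< zero    f = 0#
  Σ< (suc n) f = Σ< n f + f n

  sumList : List Carrier → Carrier
  sumList = List.foldr _+_ 0#

  pow : Carrier → ℕ → Carrier
  pow x zero    = 1#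
  pow x (suc n) = x * pow x n

  -- Formal power series 𝓕 = 𝕂[[x]] as coefficient sequences
  -- (u n = [xⁿ] u), with coefficientwise equality.

  PS : Set c
  PS = ℕ → Carrier

  _≈ₛ_ : PS → PS → Set ℓ
  u ≈ₛ v = ∀ n → u n ≈ v n

  constₛ : Carrier → PS
  constₛ a zero    = a
  constₛ a (suc n) = 0#

  _+ₛ_ : PS → PS → PS
  (u +ₛ v) n = u n + v n

  _*ₛ_ : PS → PS → PS
  (u *ₛ v) n = Σ< (suc n) (λ i → u i * v (n ∸ i))

  powₛ : PS → ℕ → PS
  powₛ u zero    = constₛ 1#
  powₛ u (suc k) = u *ₛ powₛ u k

  D : PS → PS
  D u n = ι (suc n) * u (suc n)

  Dⁱ : ℕ → PS → PS
  Dⁱ zero    u = u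
  Dⁱ (suc k) u = D (Dⁱ k u)

  -- composition f ∘ g = Σₖ ([xᵏ] f) gᵏ  (for g ∈ 𝓕₀): the coefficient of
  -- xⁿ only involves k ≤ n since [xⁿ] gᵏ = 0 for k > n.
  comp₀ : PS → PS → PS
  comp₀ f g n = Σ< (suc n) (λ k → f k * powₛ g k n)

  -- Polynomials in X₀ (possibly inverted), X₁, X₂, … over 𝕂, represented
  -- by their polynomial functions (𝕂 is infinite, so this is faithful);
  -- an assignment gives the value of Xⱼ at index j.

  Poly : Set c
  Poly = (ℕ → Carrier) → Carrier

  _≈ₚ_ : Poly → Poly → Set (c ⊔ ℓ)
  P ≈ₚ Q = ∀ x → P x ≈ Q x

  _∘•_ : Poly → (ℕ → Poly) → Poly
  (P ∘• H) x = P (λ j → H j x)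

  -- Partial Bell polynomials B_{n,k}.
  -- A vector r = (r₁,…,r_n) is a Vec ℕ n (position p ↦ r_{p+1}).

  vecs : (l b : ℕ) → List (Vec ℕ l)
  vecs zero    b = [] ∷ []
  vecs (suc l) b = concatMap (λ rs → List.map (λ r → r ∷ rs) (upTo (suc b))) (vecs l b)

  rsum : ∀ {l} → Vec ℕ l → ℕ
  rsum []       = 0
  rsum (r ∷ rs) = r ℕ.+ rsum rs

  wsum : ∀ {l} → ℕ → Vec ℕ l → ℕ
  wsum i []       = 0
  wsum i (r ∷ rs) = i ℕ.* r ℕ.+ wsum (suc i) rs

  den : ∀ {l} → ℕ → Vec ℕ l → ℕ
  den i []       = 1
  den i (r ∷ rs) = (r ℕ.!) ℕ.* ((i ℕ.!) ℕ.^ r) ℕ.* den (suc i) rs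

  den≢0 : ∀ {l} (i : ℕ) (rs : Vec ℕ l) → NonZero (den i rs)
  den≢0 i []       = _
  den≢0 i (r ∷ rs) =
    m*n≢0 ((r ℕ.!) ℕ.* ((i ℕ.!) ℕ.^ r)) (den (suc i) rs)
      {{m*n≢0 (r ℕ.!) ((i ℕ.!) ℕ.^ r) {{r !≢0}} {{m^n≢0 (i ℕ.!) r {{i !≢0}}}}}}
      {{den≢0 (suc i) rs}}

  mono : ∀ {l} → ℕ → Vec ℕ l → Poly
  mono i []       x = 1#
  mono i (r ∷ rs) x = pow (x i) r * mono (suc i) rs x

  -- n! / (Π rᵢ! (i!)^{rᵢ})  (an exact division of natural numbers)
  bellCoeff : (n : ℕ) → Vec ℕ n → ℕ
  bellCoeff n rs = ((n ℕ.!) / den 1 rs) {{den≢0 1 rs}}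

  -- the sum over r with Σ rᵢ = k and Σ i rᵢ = n (each rᵢ ≤ n necessarily)
  bellSum : (n k : ℕ) → Poly
  bellSum n k x =
    sumList (List.map
      (λ rs → if (rsum rs ≡ᵇ k) ∧ (wsum 1 rs ≡ᵇ n)
              then ι (bellCoeff n rs) * mono 1 rs x
              else 0#)
      (vecs n n))

  B : ℕ → ℕ → Poly
  B zero    zero    x = 1#
  B (suc n) zero    x = 0#
  B n       (suc k) x = if suc k ≤ᵇ n then bellSum n (suc k) x else 0#

  Φ : ℕ → PS → Poly
  Φ n u x = Σ< (suc n) (λ k → Dⁱ k u 0 * B n k x)

  -- Laurent polynomials 𝕂[x⁻¹, x]:
  --   f = Σⱼ (pos)ⱼ xʲ + Σᵢ (neg)ᵢ x^{-(i+1)}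
  record Laurent : Set c where
    constructor laurent
    field
      pos : List Carrier
      neg : List Carrier

  -- evaluation of a Laurent polynomial in a (raw) ring A at an element y
  -- together with a given inverse y⁻¹
  evalL : {a : Level} {A : Set a} → (A → A → A) → (A → A → A) → A → A →
          (Carrier → A) → Laurent → A → A → A
  evalL {A = A} _⊕_ _⊗_ zeroA oneA emb (laurent ps ns) y yinv =
      goP ps oneA ⊕ goN ns yinv
    where
      goP : List Carrier → A → A
      goP []       acc = zeroA
      goP (a ∷ as) acc = (emb a ⊗ acc) ⊕ goP as (acc ⊗ y)
      goN : List Carrier → A → A
      goN []       acc = zeroA
      goN (b ∷ bs) acc = (emb b ⊗ acc) ⊕ goN bs (acc ⊗ yinv)

  -- the derivation D on Laurent polynomials:
  --   D xʲ = j x^{j-1},  D x^{-(i+1)} = -(i+1) x^{-(i+2)}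
  DL : Laurent → Laurent
  DL (laurent ps ns) = laurent (dP ps) (0# ∷ dN 1 ns)
    where
      dPfrom : ℕ → List Carrier → List Carrier
      dPfrom m []       = []
      dPfrom m (a ∷ as) = (ι m * a) ∷ dPfrom (suc m) as
      dP : List Carrier → List Carrier
      dP []       = []
      dP (a ∷ as) = dPfrom 1 as
      dN : ℕ → List Carrier → List Carrier
      dN m []       = []
      dN m (b ∷ bs) = (- (ι m * b)) ∷ dN (suc m) bs

  DLⁱ : ℕ → Laurent → Laurent
  DLⁱ zero    f = f
  DLⁱ (suc k) f = DL (DLⁱ k f)

  module _ (F : IsCharZeroField) where
    open IsCharZeroField F

    evalK : Laurent → Carrier → Carrier
    evalK f y = evalL _+_ _*_ 0# 1# (λ a → a) f y (y ⁻¹)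

    -- multiplicative inverse in 𝓕 of g ∈ 𝓕₁ (g 0 ≉ 0), by the usual
    -- recursion v₀ = g₀⁻¹, vₙ = -g₀⁻¹ Σ_{k=1}^{n} gₖ v_{n-k}.
    -- invVec g n = (vₙ, v_{n-1}, …, v₀)
    invVec : PS → (n : ℕ) → Vec Carrier (suc n)
    invVec g zero    = (g 0 ⁻¹) ∷ []
    invVec g (suc n) =
      (- ((g 0 ⁻¹) * sumList (Vec.toList
            (Vec.tabulate (λ (p : Fin (suc n)) →
               g (suc (toℕ p)) * lookup (invVec g n) p)))))
      ∷ invVec g n

    invₛ : PS → PS
    invₛ g n = Vec.head (invVec g n)

    comp₁ : Laurent → PS → PS
    comp₁ f g = evalL _+ₛ_ _*ₛ_ (constₛ 0#) (constₛ 1#) constₛ f g (invₛ g)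

    ΦL : ℕ → Laurent → Poly
    ΦL n f x = Σ< (suc n) (λ k → evalK (DLⁱ k f) (x 0) * B n k x)

-- Everything is read off the exponential generating series egf x = Σ_{j≥1} xⱼ tʲ/j!.
-- By the multinomial theorem, k! B_{n,k}(x) = n! [tⁿ] (egf x)ᵏ, hence
-- Φₙ(u)(x) = n! [tⁿ] (u ∘ egf x), and in particular egf (Φ•(g)(x)) = (g − g(0)) ∘ egf x.
-- Associativity of composition then gives Φₙ(f ∘ (g − g(0))) = Φₙ(f)(Φ•(g)). At
-- x = e₁ = (0, 1, 0, …) one has egf x = t, so Φₙ(h)(e₁) = n! hₙ and the Φₙ(h) determine h.
-- In the 1-case f ∘ g is first replaced by its Taylor expansion Σₖ f⁽ᵏ⁾(g(0))/k! (g − g(0))ᵏ.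
-- Identities between series (multiplicativity and associativity of composition, the Taylor
-- expansion) are proved by comparing constant terms and derivatives, using the chain rule
-- and characteristic zero.
module Submission where

open import Defs

open import Level using (Level; _⊔_)
open import Algebra.Bundles using (CommutativeRing)
open import Data.Bool using (true; false; if_then_else_; _∧_)
open import Data.Bool.Properties using (∧-zeroʳ)
open import Data.Empty using (⊥-elim)
open import Data.Fin as Fin using (Fin)
open import Data.List as List using (List; []; _∷_; _++_; concatMap; upTo; applyUpTo)
import Data.List.Properties as List
open import Data.Nat as ℕ using (ℕ; zero; suc; _≤_; _<_; z≤n; s≤s; _∸_; _!)
import Data.Nat.Properties as ℕ
open import Data.Nat.Combinatorics using (_C_; k![n∸k]!∣n!; nCk≡n!/k![n-k]!)
open import Data.Nat.Divisibility using (_∣_; 1∣_; ∣-trans; *-pres-∣; *-monoʳ-∣)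
open import Data.Nat.DivMod using (m*[n/m]≡n)
open import Data.Nat.Tactic.RingSolver using (solve-∀)
open import Data.Product using (_×_; _,_)
open import Data.Sum using (inj₁; inj₂)
open import Data.Vec as Vec using (Vec; []; _∷_)
open import Function using (_∘_; id)
open import Function.Bundles using (_⇔_; mk⇔)
open import Relation.Binary.PropositionalEquality as ≡ using (_≡_; _≢_)
open import Relation.Nullary using (¬_; yes; no)
open import Relation.Nullary.Decidable using (dec-true; dec-false; does-⇔)
import Relation.Binary.Reasoning.Setoid as SetoidReasoning
import Algebra.Properties.AbelianGroup as AbelianGroupProperties
import Algebra.Properties.CommutativeSemigroup as CommutativeSemigroupProperties
import Algebra.Properties.CommutativeSemiring.Binomial as Binomial
import Algebra.Properties.CommutativeSemiring.Exp as CommutativeSemiringExp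
import Algebra.Properties.Group as GroupProperties
import Algebra.Properties.Monoid.Sum as MonoidSum
import Algebra.Properties.Ring as RingProperties
import Algebra.Properties.Semiring.Exp as SemiringExp
import Algebra.Properties.Semiring.Mult as SemiringMult
import Algebra.Solver.CommutativeMonoid as CommutativeMonoidSolver
import Algebra.Solver.Ring.NaturalCoefficients.Default as RingSolver

m!*n!∣[m+n]! : ∀ m n → m ! ℕ.* n ! ∣ (m ℕ.+ n) !
m!*n!∣[m+n]! m n =
  ≡.subst (λ k → m ! ℕ.* k ! ∣ (m ℕ.+ n) !) (ℕ.m+n∸m≡n m n) (k![n∸k]!∣n! (ℕ.m≤m+n m n))

r!*[[1+k]!]^r∣[[1+k]*r]! : ∀ k r → r ! ℕ.* (suc k !) ℕ.^ r ∣ (suc k ℕ.* r) !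
r!*[[1+k]!]^r∣[[1+k]*r]! k zero    = 1∣ _
r!*[[1+k]!]^r∣[[1+k]*r]! k (suc r) =
  ≡.subst₂ _∣_ (regroup k r (k !) (r !) ((suc k !) ℕ.^ r)) (≡.cong _! (suc-k+[suc-k*r] k r))
    (*-monoʳ-∣ (suc (k ℕ.+ suc k ℕ.* r))
      (∣-trans (*-monoʳ-∣ (k !) (r!*[[1+k]!]^r∣[[1+k]*r]! k r)) (m!*n!∣[m+n]! k (suc k ℕ.* r))))
  where
  regroup : ∀ k r x y z →
    suc (k ℕ.+ suc k ℕ.* r) ℕ.* (x ℕ.* (y ℕ.* z)) ≡ (suc r ℕ.* y) ℕ.* ((suc k ℕ.* x) ℕ.* z)
  regroup = solve-∀
  suc-k+[suc-k*r] : ∀ k r → suc (k ℕ.+ suc k ℕ.* r) ≡ suc k ℕ.* suc r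
  suc-k+[suc-k*r] = solve-∀

r!*[k∸r]!*kCr≡k! : ∀ {k r} → r ℕ.≤ k → r ! ℕ.* (k ∸ r) ! ℕ.* (k C r) ≡ k !
r!*[k∸r]!*kCr≡k! {k} {r} r≤k = ≡.trans (≡.cong (r ! ℕ.* (k ∸ r) ! ℕ.*_) (nCk≡n!/k![n-k]! r≤k))
                                        (m*[n/m]≡n {{r ℕ.!* (k ∸ r) !≢0}} (k![n∸k]!∣n! r≤k))

[r+s≡ᵇn]≡[s≡ᵇn∸r] : ∀ r s {n} → r ≤ n → (r ℕ.+ s ℕ.≡ᵇ n) ≡ (s ℕ.≡ᵇ n ∸ r)
[r+s≡ᵇn]≡[s≡ᵇn∸r] r s {n} r≤n = does-⇔
  (mk⇔ (λ r+s≡n → ≡.trans (≡.sym (ℕ.m+n∸m≡n r s)) (≡.cong (_∸ r) r+s≡n))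
       (λ s≡n∸r → ≡.trans (≡.cong (r ℕ.+_) s≡n∸r) (ℕ.m+[n∸m]≡n r≤n)))
  (r ℕ.+ s ℕ.≟ n) (s ℕ.≟ n ∸ r)

[r+s≡ᵇn]≡false : ∀ r s {n} → n < r → (r ℕ.+ s ℕ.≡ᵇ n) ≡ false
[r+s≡ᵇn]≡false r s {n} n<r =
  dec-false (r ℕ.+ s ℕ.≟ n) (λ r+s≡n → ℕ.<⇒≱ n<r (≡.subst (r ≤_) r+s≡n (ℕ.m≤m+n r s)))

module _ {c ℓ : Level} (K : CommutativeRing c ℓ) where

  den∣[wsum]! : ∀ k {l} (rs : Vec ℕ l) → den K (suc k) rs ∣ (wsum K (suc k) rs) !
  den∣[wsum]! k []       = 1∣ 1
  den∣[wsum]! k (r ∷ rs) =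
    ∣-trans (*-pres-∣ (r!*[[1+k]!]^r∣[[1+k]*r]! k r) (den∣[wsum]! (suc k) rs))
            (m!*n!∣[m+n]! (suc k ℕ.* r) (wsum K (suc (suc k)) rs))

  den*bellCoeff≡n! : ∀ n (rs : Vec ℕ n) → wsum K 1 rs ≡ n → den K 1 rs ℕ.* bellCoeff K n rs ≡ n !
  den*bellCoeff≡n! n rs wsum≡n =
    m*[n/m]≡n {{den≢0 K 1 rs}} (≡.subst (λ m → den K 1 rs ∣ m !) wsum≡n (den∣[wsum]! 0 rs))

module Sums {c ℓ : Level} (R : CommutativeRing c ℓ) where
  open CommutativeRing R
  open SetoidReasoning setoid
  open CommutativeSemigroupProperties +-commutativeSemigroup using (interchange)
  open MonoidSum +-monoid using (sum)
  open SemiringExp semiring using (_^_; ^-congˡ)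
  open CommutativeSemiringExp commutativeSemiring using (^-distrib-*)
  open SemiringMult semiring using (×-homo-+; ×1-homo-*; ×-assoc-*; ×-congʳ) renaming (_×_ to _·_)

  Σ<-cong : ∀ n {f g : ℕ → Carrier} → (∀ i → i < n → f i ≈ g i) → Σ< R n f ≈ Σ< R n g
  Σ<-cong zero    f≈g = refl
  Σ<-cong (suc n) f≈g = +-cong (Σ<-cong n (λ i i<n → f≈g i (ℕ.m<n⇒m<1+n i<n))) (f≈g n ℕ.≤-refl)

  Σ<-zero : ∀ n {f : ℕ → Carrier} → (∀ i → i < n → f i ≈ 0#) → Σ< R n f ≈ 0#
  Σ<-zero zero    f≈0 = refl
  Σ<-zero (suc n) f≈0 =
    trans (+-cong (Σ<-zero n (λ i i<n → f≈0 i (ℕ.m<n⇒m<1+n i<n))) (f≈0 n ℕ.≤-refl)) (+-identityˡ 0#)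

  Σ<-+ : ∀ n (f g : ℕ → Carrier) → Σ< R n (λ i → f i + g i) ≈ Σ< R n f + Σ< R n g
  Σ<-+ zero    f g = sym (+-identityˡ 0#)
  Σ<-+ (suc n) f g = trans (+-congʳ (Σ<-+ n f g)) (interchange _ _ _ _)

  *-distribˡ-Σ< : ∀ n a (f : ℕ → Carrier) → a * Σ< R n f ≈ Σ< R n (λ i → a * f i)
  *-distribˡ-Σ< zero    a f = zeroʳ a
  *-distribˡ-Σ< (suc n) a f = trans (distribˡ a _ _) (+-congʳ (*-distribˡ-Σ< n a f))

  *-distribʳ-Σ< : ∀ n a (f : ℕ → Carrier) → Σ< R n f * a ≈ Σ< R n (λ i → f i * a)
  *-distribʳ-Σ< zero    a f = zeroˡ a
  *-distribʳ-Σ< (suc n) a f = trans (distribʳ a _ _) (+-congʳ (*-distribʳ-Σ< n a f))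

  *-distribˡ-if : ∀ b a x → a * (if b then x else 0#) ≈ (if b then a * x else 0#)
  *-distribˡ-if true  a x = refl
  *-distribˡ-if false a x = zeroʳ a

  Σ<-suc : ∀ n (f : ℕ → Carrier) → Σ< R (suc n) f ≈ f 0 + Σ< R n (λ i → f (suc i))
  Σ<-suc zero    f = trans (+-identityˡ _) (sym (+-identityʳ _))
  Σ<-suc (suc n) f = trans (+-congʳ (Σ<-suc n f)) (+-assoc _ _ _)

  Σ<-swap : ∀ m n (F : ℕ → ℕ → Carrier) →
            Σ< R m (λ i → Σ< R n (F i)) ≈ Σ< R n (λ j → Σ< R m (λ i → F i j))
  Σ<-swap zero    n F = sym (Σ<-zero n (λ _ _ → refl))
  Σ<-swap (suc m) n F = trans (+-congʳ (Σ<-swap m n F)) (sym (Σ<-+ n _ _))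

  Σ<-extend : ∀ {m} n (f : ℕ → Carrier) → m ≤ n → (∀ i → m ≤ i → f i ≈ 0#) → Σ< R n f ≈ Σ< R m f
  Σ<-extend {m} n f m≤n f≈0 with ℕ.m≤n⇒m<n∨m≡n m≤n
  Σ<-extend {m} (suc n) f m≤n f≈0 | inj₁ m<1+n =
    trans (+-cong (Σ<-extend n f (ℕ.≤-pred m<1+n) f≈0) (f≈0 n (ℕ.≤-pred m<1+n))) (+-identityʳ _)
  Σ<-extend n f m≤n f≈0 | inj₂ ≡.refl = refl

  Σ<-reverse : ∀ n (f : ℕ → Carrier) → Σ< R n f ≈ Σ< R n (λ i → f (n ∸ suc i))
  Σ<-reverse zero    f = refl
  Σ<-reverse (suc n) f = trans (+-congʳ (Σ<-reverse n f)) (trans (+-comm _ _) (sym (Σ<-suc n _)))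

  Σ<-triangle : ∀ n (F : ℕ → ℕ → Carrier) →
    Σ< R n (λ m → Σ< R (suc m) (λ i → F i (m ∸ i))) ≈ Σ< R n (λ i → Σ< R (n ∸ i) (F i))
  Σ<-triangle zero    F = refl
  Σ<-triangle (suc n) F = begin
    Σ< R n (λ m → Σ< R (suc m) (λ i → F i (m ∸ i))) + Σ< R (suc n) (λ i → F i (n ∸ i))
      ≈⟨ +-congʳ (Σ<-triangle n F) ⟩
    Σ< R n (λ i → Σ< R (n ∸ i) (F i)) + Σ< R (suc n) (λ i → F i (n ∸ i))
      ≈⟨ +-congʳ (sym (trans (+-congˡ (reflexive (≡.cong (λ k → Σ< R k (F n)) (ℕ.n∸n≡0 n))))
                                (+-identityʳ _))) ⟩
    Σ< R (suc n) (λ i → Σ< R (n ∸ i) (F i)) + Σ< R (suc n) (λ i → F i (n ∸ i))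
      ≈⟨ Σ<-+ (suc n) _ _ ⟨
    Σ< R (suc n) (λ i → Σ< R (n ∸ i) (F i) + F i (n ∸ i))
      ≈⟨ Σ<-cong (suc n) (λ i i<1+n →
           reflexive (≡.cong (λ k → Σ< R k (F i)) (≡.sym (ℕ.+-∸-assoc 1 (ℕ.≤-pred i<1+n))))) ⟩
    Σ< R (suc n) (λ i → Σ< R (suc n ∸ i) (F i)) ∎

  Σ<-single : ∀ n p (f : ℕ → Carrier) → p < n → (∀ j → j < n → j ≢ p → f j ≈ 0#) → Σ< R n f ≈ f p
  Σ<-single (suc n) p f p<1+n f≈0 with p ℕ.≟ n
  ... | yes ≡.refl =
    trans (+-congʳ (Σ<-zero n (λ j j<n → f≈0 j (ℕ.m<n⇒m<1+n j<n) (ℕ.<⇒≢ j<n)))) (+-identityˡ _)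
  ... | no p≢n =
    trans (+-cong (Σ<-single n p f (ℕ.≤∧≢⇒< (ℕ.≤-pred p<1+n) p≢n) (λ j j<n → f≈0 j (ℕ.m<n⇒m<1+n j<n)))
                  (f≈0 n ℕ.≤-refl (p≢n ∘ ≡.sym)))
          (+-identityʳ _)

  sumList-cong : ∀ {a} {A : Set a} (xs : List A) {f g : A → Carrier} → (∀ x → f x ≈ g x) →
                 sumList R (List.map f xs) ≈ sumList R (List.map g xs)
  sumList-cong []       f≈g = refl
  sumList-cong (x ∷ xs) f≈g = +-cong (f≈g x) (sumList-cong xs f≈g)

  sumList-zero : ∀ {a} {A : Set a} (xs : List A) {f : A → Carrier} → (∀ x → f x ≈ 0#) →
                 sumList R (List.map f xs) ≈ 0#
  sumList-zero []       f≈0 = refl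
  sumList-zero (x ∷ xs) f≈0 = trans (+-cong (f≈0 x) (sumList-zero xs f≈0)) (+-identityˡ _)

  sumList-++ : ∀ xs ys → sumList R (xs ++ ys) ≈ sumList R xs + sumList R ys
  sumList-++ []       ys = sym (+-identityˡ _)
  sumList-++ (x ∷ xs) ys = trans (+-congˡ (sumList-++ xs ys)) (sym (+-assoc _ _ _))

  sumList-concatMap : ∀ {a b} {A : Set a} {B : Set b} (f : B → Carrier) (g : A → List B) xs →
    sumList R (List.map f (concatMap g xs)) ≈ sumList R (List.map (λ x → sumList R (List.map f (g x))) xs)
  sumList-concatMap f g []       = refl
  sumList-concatMap f g (x ∷ xs) = begin
    sumList R (List.map f (g x ++ concatMap g xs))
      ≡⟨ ≡.cong (sumList R) (List.map-++ f (g x) (concatMap g xs)) ⟩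
    sumList R (List.map f (g x) ++ List.map f (concatMap g xs))
      ≈⟨ sumList-++ (List.map f (g x)) _ ⟩
    sumList R (List.map f (g x)) + sumList R (List.map f (concatMap g xs))
      ≈⟨ +-congˡ (sumList-concatMap f g xs) ⟩
    sumList R (List.map (λ x → sumList R (List.map f (g x))) (x ∷ xs)) ∎

  sumList-Σ< : ∀ {a} {A : Set a} (xs : List A) n (F : A → ℕ → Carrier) →
    sumList R (List.map (λ x → Σ< R n (F x)) xs) ≈ Σ< R n (λ i → sumList R (List.map (λ x → F x i) xs))
  sumList-Σ< []       n F = sym (Σ<-zero n (λ _ _ → refl))
  sumList-Σ< (x ∷ xs) n F = trans (+-congˡ (sumList-Σ< xs n F)) (sym (Σ<-+ n _ _))

  sumList-applyUpTo : ∀ n (g : ℕ → ℕ) (f : ℕ → Carrier) →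
                      sumList R (List.map f (applyUpTo g n)) ≈ Σ< R n (λ i → f (g i))
  sumList-applyUpTo zero    g f = refl
  sumList-applyUpTo (suc n) g f =
    trans (+-congˡ (sumList-applyUpTo n (λ i → g (suc i)) f)) (sym (Σ<-suc n _))

  *-distribˡ-sumList : ∀ {a} {A : Set a} (xs : List A) x (f : A → Carrier) →
    x * sumList R (List.map f xs) ≈ sumList R (List.map (λ y → x * f y) xs)
  *-distribˡ-sumList []       x f = zeroʳ x
  *-distribˡ-sumList (y ∷ ys) x f = trans (distribˡ x _ _) (+-congˡ (*-distribˡ-sumList ys x f))

  sumList-tabulate : ∀ n (f : Fin n → Carrier) (g : ℕ → Carrier) → (∀ i → f i ≈ g (Fin.toℕ i)) →
                     sumList R (Vec.toList (Vec.tabulate f)) ≈ Σ< R n g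
  sumList-tabulate zero    f g f≈g = refl
  sumList-tabulate (suc n) f g f≈g = trans
    (+-cong (f≈g Fin.zero) (sumList-tabulate n (f ∘ Fin.suc) (g ∘ suc) (f≈g ∘ Fin.suc)))
    (sym (Σ<-suc n g))

  Σ<≈sum : ∀ n (f : ℕ → Carrier) → Σ< R n f ≈ sum (λ (i : Fin n) → f (Fin.toℕ i))
  Σ<≈sum zero    f = refl
  Σ<≈sum (suc n) f = trans (Σ<-suc n f) (+-congˡ (Σ<≈sum n (f ∘ suc)))

  ι≡·1 : ∀ n → ι R n ≡ n · 1#
  ι≡·1 zero    = ≡.refl
  ι≡·1 (suc n) = ≡.cong (1# +_) (ι≡·1 n)

  ·≈ι* : ∀ n x → n · x ≈ ι R n * x
  ·≈ι* n x rewrite ι≡·1 n = sym (trans (×-assoc-* n 1# x) (×-congʳ n (*-identityˡ x)))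

  ι-+ : ∀ m n → ι R (m ℕ.+ n) ≈ ι R m + ι R n
  ι-+ m n rewrite ι≡·1 (m ℕ.+ n) | ι≡·1 m | ι≡·1 n = ×-homo-+ 1# m n

  ι-* : ∀ m n → ι R (m ℕ.* n) ≈ ι R m * ι R n
  ι-* m n rewrite ι≡·1 (m ℕ.* n) | ι≡·1 m | ι≡·1 n = ×1-homo-* m n

  pow≡^ : ∀ x n → pow R x n ≡ x ^ n
  pow≡^ x zero    = ≡.refl
  pow≡^ x (suc n) = ≡.cong (x *_) (pow≡^ x n)

  pow-cong : ∀ {x y} n → x ≈ y → pow R x n ≈ pow R y n
  pow-cong {x} {y} n x≈y rewrite pow≡^ x n | pow≡^ y n = ^-congˡ n x≈y

  pow-distrib-* : ∀ x y n → pow R (x * y) n ≈ pow R x n * pow R y n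
  pow-distrib-* x y n rewrite pow≡^ (x * y) n | pow≡^ x n | pow≡^ y n = ^-distrib-* x y n

  pow-1# : ∀ n → pow R 1# n ≈ 1#
  pow-1# zero    = refl
  pow-1# (suc n) = trans (*-identityˡ _) (pow-1# n)

  ι-^ : ∀ m n → ι R (m ℕ.^ n) ≈ pow R (ι R m) n
  ι-^ m zero    = +-identityʳ 1#
  ι-^ m (suc n) = trans (ι-* m (m ℕ.^ n)) (*-congˡ (ι-^ m n))

module PowerSeries {c ℓ : Level} (K : CommutativeRing c ℓ) where
  open CommutativeRing K hiding (zero)
  open SetoidReasoning setoid
  open CommutativeSemigroupProperties *-commutativeSemigroup using (x∙yz≈y∙xz)
  open Sums K

  infix  4 _≋_
  infixl 6 _⊕_
  infixl 7 _⊛_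

  _≋_ : PS K → PS K → Set ℓ
  _≋_ = _≈ₛ_ K

  _⊕_ _⊛_ : PS K → PS K → PS K
  _⊕_ = _+ₛ_ K
  _⊛_ = _*ₛ_ K

  ⊖_ : PS K → PS K
  (⊖ u) n = - u n

  cst : Carrier → PS K
  cst = constₛ K

  𝟘 𝟙 : PS K
  𝟘 = cst 0#
  𝟙 = cst 1#

  𝟘≈0 : ∀ n → 𝟘 n ≈ 0#
  𝟘≈0 zero    = refl
  𝟘≈0 (suc n) = refl

  ⊛-cong : ∀ {u u′ v v′} → u ≋ u′ → v ≋ v′ → u ⊛ v ≋ u′ ⊛ v′
  ⊛-cong u≋u′ v≋v′ n = Σ<-cong (suc n) (λ i _ → *-cong (u≋u′ i) (v≋v′ (n ∸ i)))

  ⊛-comm : ∀ u v → u ⊛ v ≋ v ⊛ u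
  ⊛-comm u v n = begin
    Σ< K (suc n) (λ i → u i * v (n ∸ i))                    ≈⟨ Σ<-reverse (suc n) _ ⟩
    Σ< K (suc n) (λ i → u (n ∸ i) * v (n ∸ (n ∸ i)))         ≈⟨ Σ<-cong (suc n) (λ i i≤n →
      trans (*-comm _ _) (*-congʳ (reflexive (≡.cong v (ℕ.m∸[m∸n]≡n (ℕ.≤-pred i≤n)))))) ⟩
    Σ< K (suc n) (λ i → v i * u (n ∸ i))                    ∎

  ⊛-identityˡ : ∀ u → 𝟙 ⊛ u ≋ u
  ⊛-identityˡ u n = begin
    Σ< K (suc n) (λ i → 𝟙 i * u (n ∸ i))                ≈⟨ Σ<-suc n _ ⟩
    1# * u n + Σ< K n (λ i → 0# * u (n ∸ suc i))
      ≈⟨ +-cong (*-identityˡ _) (Σ<-zero n (λ i _ → zeroˡ _)) ⟩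
    u n + 0#                                            ≈⟨ +-identityʳ _ ⟩
    u n                                                 ∎

  ⊛-distribˡ : ∀ u v w → u ⊛ (v ⊕ w) ≋ u ⊛ v ⊕ u ⊛ w
  ⊛-distribˡ u v w n = trans (Σ<-cong (suc n) (λ i _ → distribˡ _ _ _)) (Σ<-+ (suc n) _ _)

  ⊛-assoc : ∀ u v w → (u ⊛ v) ⊛ w ≋ u ⊛ (v ⊛ w)
  ⊛-assoc u v w n = begin
    Σ< K (suc n) (λ m → Σ< K (suc m) (λ i → u i * v (m ∸ i)) * w (n ∸ m))
      ≈⟨ Σ<-cong (suc n) (λ m m≤n → trans (*-distribʳ-Σ< (suc m) _ _) (Σ<-cong (suc m) (λ i i≤m →
           trans (*-assoc _ _ _) (*-congˡ (*-congˡ (reflexive (≡.cong w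
             (n∸m≡[n∸i]∸[m∸i] (ℕ.≤-pred i≤m))))))))) ⟩
    Σ< K (suc n) (λ m → Σ< K (suc m) (λ i → T i (m ∸ i)))
      ≈⟨ Σ<-triangle (suc n) T ⟩
    Σ< K (suc n) (λ i → Σ< K (suc n ∸ i) (T i))
      ≈⟨ Σ<-cong (suc n) (λ i i≤n → trans
           (reflexive (≡.cong (λ k → Σ< K k (T i)) (ℕ.+-∸-assoc 1 (ℕ.≤-pred i≤n))))
           (sym (*-distribˡ-Σ< (suc (n ∸ i)) _ _))) ⟩
    Σ< K (suc n) (λ i → u i * (v ⊛ w) (n ∸ i)) ∎
    where
    T : ℕ → ℕ → Carrier
    T i j = u i * (v j * w ((n ∸ i) ∸ j))
    n∸m≡[n∸i]∸[m∸i] : ∀ {i m} → i ≤ m → n ∸ m ≡ (n ∸ i) ∸ (m ∸ i)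
    n∸m≡[n∸i]∸[m∸i] {i} {m} i≤m =
      ≡.trans (≡.cong (n ∸_) (≡.sym (ℕ.m+[n∸m]≡n i≤m))) (≡.sym (ℕ.∸-+-assoc n i (m ∸ i)))

  PS-ring : CommutativeRing c ℓ
  PS-ring = record
    { Carrier = PS K ; _≈_ = _≋_ ; _+_ = _⊕_ ; _*_ = _⊛_ ; -_ = ⊖_ ; 0# = 𝟘 ; 1# = 𝟙
    ; isCommutativeRing = record
      { isRing = record
        { +-isAbelianGroup = record
          { isGroup = record
            { isMonoid = record
              { isSemigroup = record
                { isMagma = record
                  { isEquivalence = record
                    { refl = λ n → refl ; sym = λ e n → sym (e n) ; trans = λ e f n → trans (e n) (f n) }
                  ; ∙-cong = λ e f n → +-cong (e n) (f n) }
                ; assoc = λ u v w n → +-assoc _ _ _ }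
              ; identity = (λ u n → trans (+-congʳ (𝟘≈0 n)) (+-identityˡ _))
                         , (λ u n → trans (+-congˡ (𝟘≈0 n)) (+-identityʳ _)) }
            ; inverse = (λ u n → trans (-‿inverseˡ _) (sym (𝟘≈0 n)))
                      , (λ u n → trans (-‿inverseʳ _) (sym (𝟘≈0 n)))
            ; ⁻¹-cong = λ e n → -‿cong (e n) }
          ; comm = λ u v n → +-comm _ _ }
        ; *-cong = ⊛-cong
        ; *-assoc = ⊛-assoc
        ; *-identity = ⊛-identityˡ , (λ u n → trans (⊛-comm u 𝟙 n) (⊛-identityˡ u n))
        ; distrib = ⊛-distribˡ
                  , (λ u v w n → trans (⊛-comm (v ⊕ w) u n)
                      (trans (⊛-distribˡ u v w n) (+-cong (⊛-comm u v n) (⊛-comm u w n)))) }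
      ; *-comm = ⊛-comm } }

  module 𝓕 where
    open CommutativeRing PS-ring public
    open SetoidReasoning (CommutativeRing.setoid PS-ring) public
    open CommutativeSemigroupProperties (CommutativeRing.*-commutativeSemigroup PS-ring) public
      using (x∙yz≈y∙xz; xy∙z≈xz∙y; interchange)

  -- 𝓕.*-congˡ and 𝓕.*-congʳ with the fixed factor explicit: unification cannot recover
  -- it from a coefficientwise equality.
  ⊛-congˡ : ∀ u {v v′} → v ≋ v′ → u ⊛ v ≋ u ⊛ v′
  ⊛-congˡ u = ⊛-cong {u} {u} (λ _ → refl)

  ⊛-congʳ : ∀ {u u′} v → u ≋ u′ → u ⊛ v ≋ u′ ⊛ v
  ⊛-congʳ v u≋u′ = ⊛-cong {v = v} {v} u≋u′ (λ _ → refl)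

  ⊕-congˡ : ∀ u {v v′} → v ≋ v′ → u ⊕ v ≋ u ⊕ v′
  ⊕-congˡ u v≋v′ n = +-congˡ (v≋v′ n)

  ⊕-congʳ : ∀ {u u′} v → u ≋ u′ → u ⊕ v ≋ u′ ⊕ v
  ⊕-congʳ v u≋u′ n = +-congʳ (u≋u′ n)

  cst-cong : ∀ {a b} → a ≈ b → cst a ≋ cst b
  cst-cong a≈b zero    = a≈b
  cst-cong a≈b (suc n) = refl

  cst-+ : ∀ a b → cst (a + b) ≋ cst a ⊕ cst b
  cst-+ a b zero    = refl
  cst-+ a b (suc n) = sym (+-identityʳ 0#)

  cst-neg : ∀ a → cst (- a) ≋ ⊖ cst a
  cst-neg a zero    = refl
  cst-neg a (suc n) = sym (trans (sym (+-identityʳ _)) (-‿inverseˡ 0#))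

  coeff-cst⊛ : ∀ a u n → (cst a ⊛ u) n ≈ a * u n
  coeff-cst⊛ a u n = trans (Σ<-suc n _) (trans (+-congˡ (Σ<-zero n (λ i _ → zeroˡ _))) (+-identityʳ _))

  cst-* : ∀ a b → cst (a * b) ≋ cst a ⊛ cst b
  cst-* a b zero    = sym (coeff-cst⊛ a (cst b) zero)
  cst-* a b (suc n) = sym (trans (coeff-cst⊛ a (cst b) (suc n)) (zeroʳ a))

  ι≋cst : ∀ n → ι PS-ring n ≋ cst (ι K n)
  ι≋cst zero    = 𝓕.refl
  ι≋cst (suc n) = 𝓕.trans (⊕-congˡ 𝟙 (ι≋cst n)) (𝓕.sym (cst-+ 1# (ι K n)))

  Σ<-coeff : ∀ N (U : ℕ → PS K) m → Σ< PS-ring N U m ≈ Σ< K N (λ r → U r m)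
  Σ<-coeff zero    U m = 𝟘≈0 m
  Σ<-coeff (suc N) U m = +-congʳ (Σ<-coeff N U m)

  coeff₀-⊛ : ∀ u v → (u ⊛ v) 0 ≈ u 0 * v 0
  coeff₀-⊛ u v = +-identityˡ _

  infix 4 _≋[_]_
  _≋[_]_ : PS K → ℕ → PS K → Set ℓ
  u ≋[ n ] v = ∀ m → m ≤ n → u m ≈ v m

  ⊕-cong-≋[] : ∀ {u u′ v v′ n} → u ≋[ n ] u′ → v ≋[ n ] v′ → u ⊕ v ≋[ n ] u′ ⊕ v′
  ⊕-cong-≋[] u≋u′ v≋v′ m m≤n = +-cong (u≋u′ m m≤n) (v≋v′ m m≤n)

  ⊛-cong-≋[] : ∀ {u u′ v v′ n} → u ≋[ n ] u′ → v ≋[ n ] v′ → u ⊛ v ≋[ n ] u′ ⊛ v′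
  ⊛-cong-≋[] u≋u′ v≋v′ m m≤n = Σ<-cong (suc m) (λ i i≤m →
    *-cong (u≋u′ i (ℕ.≤-trans (ℕ.≤-pred i≤m) m≤n)) (v≋v′ (m ∸ i) (ℕ.≤-trans (ℕ.m∸n≤m m i) m≤n)))

  powₛ-cong-≋[] : ∀ {u v n} k → u ≋[ n ] v → powₛ K u k ≋[ n ] powₛ K v k
  powₛ-cong-≋[] zero    u≋v m _ = refl
  powₛ-cong-≋[] (suc k) u≋v     = ⊛-cong-≋[] u≋v (powₛ-cong-≋[] k u≋v)

  ∂ : PS K → PS K
  ∂ = D K

  ∂-cong : ∀ {u v} → u ≋ v → ∂ u ≋ ∂ v
  ∂-cong u≋v n = *-congˡ (u≋v (suc n))

  ∂-⊕ : ∀ u v → ∂ (u ⊕ v) ≋ ∂ u ⊕ ∂ v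
  ∂-⊕ u v n = distribˡ _ _ _

  ∂-cst : ∀ a → ∂ (cst a) ≋ 𝟘
  ∂-cst a n = trans (zeroʳ _) (sym (𝟘≈0 n))

  ∂-⊛ : ∀ u v → ∂ (u ⊛ v) ≋ ∂ u ⊛ v ⊕ u ⊛ ∂ v
  ∂-⊛ u v n = begin
    ι K (suc n) * Σ< K (suc (suc n)) T
      ≈⟨ *-distribˡ-Σ< (suc (suc n)) _ _ ⟩
    Σ< K (suc (suc n)) (λ i → ι K (suc n) * T i)
      ≈⟨ Σ<-cong (suc (suc n)) (λ i i≤1+n → trans (*-congʳ (trans
           (reflexive (≡.cong (ι K) (≡.sym (ℕ.m+[n∸m]≡n (ℕ.≤-pred i≤1+n))))) (ι-+ i (suc n ∸ i))))
           (distribʳ _ _ _)) ⟩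
    Σ< K (suc (suc n)) (λ i → ι K i * T i + ι K (suc n ∸ i) * T i)
      ≈⟨ Σ<-+ (suc (suc n)) _ _ ⟩
    Σ< K (suc (suc n)) (λ i → ι K i * T i) + Σ< K (suc (suc n)) (λ i → ι K (suc n ∸ i) * T i)
      ≈⟨ +-cong ∂u-part u∂-part ⟩
    (∂ u ⊛ v) n + (u ⊛ ∂ v) n ∎
    where
    T : ℕ → Carrier
    T i = u i * v (suc n ∸ i)
    ∂u-part : Σ< K (suc (suc n)) (λ i → ι K i * T i) ≈ (∂ u ⊛ v) n
    ∂u-part = trans (Σ<-suc (suc n) _)
      (trans (+-cong (zeroˡ _) (Σ<-cong (suc n) (λ i _ → sym (*-assoc _ _ _)))) (+-identityˡ _))
    u∂-part : Σ< K (suc (suc n)) (λ i → ι K (suc n ∸ i) * T i) ≈ (u ⊛ ∂ v) n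
    u∂-part = trans (+-cong
      (Σ<-cong (suc n) (λ i i≤n → trans (x∙yz≈y∙xz _ _ _)
         (*-congˡ (reflexive (≡.cong (λ k → ι K k * v k) (ℕ.+-∸-assoc 1 (ℕ.≤-pred i≤n)))))))
      (trans (*-congʳ (reflexive (≡.cong (ι K) (ℕ.n∸n≡0 n)))) (zeroˡ _)))
      (+-identityʳ _)

  ∂-powₛ : ∀ u k → ∂ (powₛ K u (suc k)) ≋ cst (ι K (suc k)) ⊛ (powₛ K u k ⊛ ∂ u)
  ∂-powₛ u zero    = 𝓕.begin
    ∂ (u ⊛ 𝟙)                    𝓕.≈⟨ ∂-cong (𝓕.*-identityʳ u) ⟩
    ∂ u                          𝓕.≈⟨ 𝓕.*-identityˡ (∂ u) ⟨
    𝟙 ⊛ ∂ u                      𝓕.≈⟨ 𝓕.*-identityˡ (𝟙 ⊛ ∂ u) ⟨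
    𝟙 ⊛ (𝟙 ⊛ ∂ u)                𝓕.≈⟨ ⊛-congʳ (𝟙 ⊛ ∂ u) (cst-cong (+-identityʳ 1#)) ⟨
    cst (ι K 1) ⊛ (𝟙 ⊛ ∂ u)      𝓕.∎
  ∂-powₛ u (suc k) = 𝓕.begin
    ∂ (u ⊛ uᵏ⁺¹)                              𝓕.≈⟨ ∂-⊛ u uᵏ⁺¹ ⟩
    ∂ u ⊛ uᵏ⁺¹ ⊕ u ⊛ ∂ uᵏ⁺¹                   𝓕.≈⟨ ⊕-congˡ (∂ u ⊛ uᵏ⁺¹) (⊛-congˡ u (∂-powₛ u k)) ⟩
    ∂ u ⊛ uᵏ⁺¹ ⊕ u ⊛ (κ ⊛ (uᵏ ⊛ ∂ u))         𝓕.≈⟨ 𝓕.+-cong (𝓕.*-comm (∂ u) uᵏ⁺¹)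
                                                  (𝓕.trans (𝓕.x∙yz≈y∙xz u κ (uᵏ ⊛ ∂ u))
                                                           (⊛-congˡ κ (𝓕.sym (𝓕.*-assoc u uᵏ (∂ u))))) ⟩
    uᵏ⁺¹ ⊛ ∂ u ⊕ κ ⊛ (uᵏ⁺¹ ⊛ ∂ u)             𝓕.≈⟨ ⊕-congʳ (κ ⊛ (uᵏ⁺¹ ⊛ ∂ u)) (𝓕.*-identityˡ (uᵏ⁺¹ ⊛ ∂ u)) ⟨
    𝟙 ⊛ (uᵏ⁺¹ ⊛ ∂ u) ⊕ κ ⊛ (uᵏ⁺¹ ⊛ ∂ u)       𝓕.≈⟨ 𝓕.distribʳ (uᵏ⁺¹ ⊛ ∂ u) 𝟙 κ ⟨
    (𝟙 ⊕ κ) ⊛ (uᵏ⁺¹ ⊛ ∂ u)                    𝓕.≈⟨ ⊛-congʳ (uᵏ⁺¹ ⊛ ∂ u) (cst-+ 1# (ι K (suc k))) ⟨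
    cst (ι K (suc (suc k))) ⊛ (uᵏ⁺¹ ⊛ ∂ u)    𝓕.∎
    where
    κ uᵏ uᵏ⁺¹ : PS K
    κ    = cst (ι K (suc k))
    uᵏ   = powₛ K u k
    uᵏ⁺¹ = powₛ K u (suc k)

  Dⁱ-coeff : ∀ k m u → ι K (m !) * Dⁱ K k u m ≈ ι K ((m ℕ.+ k) !) * u (m ℕ.+ k)
  Dⁱ-coeff zero    m u = reflexive (≡.cong (λ j → ι K (j !) * u j) (≡.sym (ℕ.+-identityʳ m)))
  Dⁱ-coeff (suc k) m u = begin
    ι K (m !) * (ι K (suc m) * Dⁱ K k u (suc m))   ≈⟨ *-assoc _ _ _ ⟨
    (ι K (m !) * ι K (suc m)) * Dⁱ K k u (suc m)   ≈⟨ *-congʳ (trans (*-comm _ _) (sym (ι-* (suc m) (m !)))) ⟩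
    ι K (suc m !) * Dⁱ K k u (suc m)               ≈⟨ Dⁱ-coeff k (suc m) u ⟩
    ι K ((suc m ℕ.+ k) !) * u (suc m ℕ.+ k)         ≡⟨ ≡.cong (λ j → ι K (j !) * u j) (≡.sym (ℕ.+-suc m k)) ⟩
    ι K ((m ℕ.+ suc k) !) * u (m ℕ.+ suc k)         ∎

  Dⁱ-at-0 : ∀ k u → Dⁱ K k u 0 ≈ ι K (k !) * u k
  Dⁱ-at-0 k u = trans (sym (trans (*-congʳ (+-identityʳ 1#)) (*-identityˡ _))) (Dⁱ-coeff k 0 u)

  powₛ-cong : ∀ {X Y} k → X ≋ Y → powₛ K X k ≋ powₛ K Y k
  powₛ-cong zero    X≋Y n = refl
  powₛ-cong (suc k) X≋Y   = ⊛-cong X≋Y (powₛ-cong k X≋Y)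

  powₛ-vanish : ∀ {X} → X 0 ≈ 0# → ∀ k n → n < k → powₛ K X k n ≈ 0#
  powₛ-vanish {X} X₀≈0 (suc k) n (s≤s n≤k) = Σ<-zero (suc n) term≈0
    where
    term≈0 : ∀ i → i < suc n → X i * powₛ K X k (n ∸ i) ≈ 0#
    term≈0 zero    _         = trans (*-congʳ X₀≈0) (zeroˡ _)
    term≈0 (suc i) (s≤s i<n) = trans (*-congˡ (powₛ-vanish X₀≈0 k (n ∸ suc i)
      (ℕ.<-≤-trans (ℕ.∸-monoʳ-< (s≤s z≤n) i<n) n≤k))) (zeroʳ _)

  comp₀-coeff₀ : ∀ f X → comp₀ K f X 0 ≈ f 0
  comp₀-coeff₀ f X = trans (+-identityˡ _) (*-identityʳ _)

  comp₀-cong : ∀ {f f′ X X′} → f ≋ f′ → X ≋ X′ → comp₀ K f X ≋ comp₀ K f′ X′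
  comp₀-cong f≋f′ X≋X′ n = Σ<-cong (suc n) (λ k _ → *-cong (f≋f′ k) (powₛ-cong k X≋X′ n))

  comp₀-extend : ∀ {X} → X 0 ≈ 0# → ∀ f N n → n < N → comp₀ K f X n ≈ Σ< K N (λ k → f k * powₛ K X k n)
  comp₀-extend X₀≈0 f N n n<N =
    sym (Σ<-extend N _ n<N (λ k n<k → trans (*-congˡ (powₛ-vanish X₀≈0 k n n<k)) (zeroʳ _)))

  comp₀-⊕ : ∀ f g X → comp₀ K (f ⊕ g) X ≋ comp₀ K f X ⊕ comp₀ K g X
  comp₀-⊕ f g X n = trans (Σ<-cong (suc n) (λ k _ → distribʳ _ _ _)) (Σ<-+ (suc n) _ _)

  dropConst : PS K → PS K
  dropConst u zero    = 0#
  dropConst u (suc n) = u (suc n)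

  comp₀-dropConst : ∀ f X n → comp₀ K f X (suc n) ≈ comp₀ K (dropConst f) X (suc n)
  comp₀-dropConst f X n = trans (Σ<-suc (suc n) _)
    (trans (+-congʳ (trans (zeroʳ _) (sym (zeroʳ _)))) (sym (Σ<-suc (suc n) _)))

  ∂-comp₀ : ∀ {X} → X 0 ≈ 0# → ∀ f → ∂ (comp₀ K f X) ≋ comp₀ K (∂ f) X ⊛ ∂ X
  ∂-comp₀ {X} X₀≈0 f n = begin
    ι K (suc n) * Σ< K (suc (suc n)) (λ k → f k * Xᵏ k (suc n))
      ≈⟨ trans (*-distribˡ-Σ< (suc (suc n)) _ _) (Σ<-cong (suc (suc n)) (λ k _ → x∙yz≈y∙xz _ _ _)) ⟩
    Σ< K (suc (suc n)) (λ k → f k * ∂ (Xᵏ k) n)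
      ≈⟨ Σ<-suc (suc n) _ ⟩
    f 0 * ∂ 𝟙 n + Σ< K (suc n) (λ k → f (suc k) * ∂ (Xᵏ (suc k)) n)
      ≈⟨ +-cong (trans (*-congˡ (trans (∂-cst 1# n) (𝟘≈0 n))) (zeroʳ _)) (Σ<-cong (suc n) (λ k _ →
           trans (*-congˡ (trans (∂-powₛ X k n) (coeff-cst⊛ (ι K (suc k)) (Xᵏ k ⊛ ∂ X) n)))
                 (x∙yz≈y∙xz _ _ _))) ⟩
    0# + Σ< K (suc n) (λ k → ι K (suc k) * (f (suc k) * (Xᵏ k ⊛ ∂ X) n))
      ≈⟨ trans (+-identityˡ _) (Σ<-cong (suc n) (λ k _ →
           trans (sym (*-assoc _ _ _)) (*-distribˡ-Σ< (suc n) _ _))) ⟩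
    Σ< K (suc n) (λ k → Σ< K (suc n) (λ p → ∂ f k * (Xᵏ k p * ∂ X (n ∸ p))))
      ≈⟨ Σ<-swap (suc n) (suc n) _ ⟩
    Σ< K (suc n) (λ p → Σ< K (suc n) (λ k → ∂ f k * (Xᵏ k p * ∂ X (n ∸ p))))
      ≈⟨ Σ<-cong (suc n) (λ p p≤n → trans (Σ<-cong (suc n) (λ k _ → sym (*-assoc _ _ _)))
           (trans (sym (*-distribʳ-Σ< (suc n) _ _))
                  (*-congʳ (sym (comp₀-extend X₀≈0 (∂ f) (suc n) p p≤n))))) ⟩
    (comp₀ K (∂ f) X ⊛ ∂ X) n ∎
    where
    Xᵏ : ℕ → PS K
    Xᵏ = powₛ K X

module CharZero {c ℓ : Level} (K : CommutativeRing c ℓ) (F : IsCharZeroField K) where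
  open CommutativeRing K hiding (zero)
  open IsCharZeroField F
  open SetoidReasoning setoid
  open CommutativeSemigroupProperties *-commutativeSemigroup using (interchange)
  open Sums K
  open PowerSeries K
  module 𝓕Σ = Sums PS-ring
  open SemiringExp 𝓕.semiring using (_^_)
  open SemiringMult 𝓕.semiring using () renaming (_×_ to _·_)

  *-cancelˡ : ∀ {x a b} → ¬ (x ≈ 0#) → x * a ≈ x * b → a ≈ b
  *-cancelˡ {x} {a} {b} x≉0 xa≈xb = begin
    a                  ≈⟨ *-identityˡ a ⟨
    1# * a             ≈⟨ *-congʳ (trans (*-comm _ _) (⁻¹-inverse x x≉0)) ⟨
    (x ⁻¹ * x) * a     ≈⟨ *-assoc _ _ _ ⟩
    x ⁻¹ * (x * a)     ≈⟨ *-congˡ xa≈xb ⟩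
    x ⁻¹ * (x * b)     ≈⟨ *-assoc _ _ _ ⟨
    (x ⁻¹ * x) * b     ≈⟨ *-congʳ (trans (*-comm _ _) (⁻¹-inverse x x≉0)) ⟩
    1# * b             ≈⟨ *-identityˡ b ⟩
    b                  ∎

  ⁻¹-unique : ∀ {x y} → ¬ (x ≈ 0#) → x * y ≈ 1# → y ≈ x ⁻¹
  ⁻¹-unique {x} x≉0 xy≈1 = *-cancelˡ x≉0 (trans xy≈1 (sym (⁻¹-inverse x x≉0)))

  ⁻¹-cong : ∀ {x y} → ¬ (x ≈ 0#) → x ≈ y → x ⁻¹ ≈ y ⁻¹
  ⁻¹-cong {x} x≉0 x≈y =
    ⁻¹-unique (λ y≈0 → x≉0 (trans x≈y y≈0)) (trans (*-congʳ (sym x≈y)) (⁻¹-inverse x x≉0))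

  ι!≉0 : ∀ k → ¬ (ι K (k !) ≈ 0#)
  ι!≉0 k = ι≉0 (k !) {{ℕ._!≢0 k}}
    where
    ι≉0 : ∀ n .{{_ : ℕ.NonZero n}} → ¬ (ι K n ≈ 0#)
    ι≉0 (suc n) = charZero n

  infix 10 _!⁻¹
  _!⁻¹ : ℕ → Carrier
  k !⁻¹ = ι K (k !) ⁻¹

  ι!*!⁻¹≈1 : ∀ k → ι K (k !) * k !⁻¹ ≈ 1#
  ι!*!⁻¹≈1 k = ⁻¹-inverse _ (ι!≉0 k)

  0!⁻¹≈1 : 0 !⁻¹ ≈ 1#
  0!⁻¹≈1 = sym (⁻¹-unique (ι!≉0 0) (trans (*-identityʳ _) (+-identityʳ _)))

  ι[1+k]*[1+k]!⁻¹≈k!⁻¹ : ∀ k → ι K (suc k) * suc k !⁻¹ ≈ k !⁻¹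
  ι[1+k]*[1+k]!⁻¹≈k!⁻¹ k = ⁻¹-unique (ι!≉0 k) (begin
    ι K (k !) * (ι K (suc k) * suc k !⁻¹)   ≈⟨ *-assoc _ _ _ ⟨
    (ι K (k !) * ι K (suc k)) * suc k !⁻¹   ≈⟨ *-congʳ (trans (*-comm _ _) (sym (ι-* (suc k) (k !)))) ⟩
    ι K (suc k !) * suc k !⁻¹               ≈⟨ ι!*!⁻¹≈1 (suc k) ⟩
    1#                                      ∎)

  -- Induction on the coefficient index n for all members of the family at once, so that
  -- the step for U p may use the agreement of other members (such as p = ∂ f); the factor
  -- n + 1 in ∂ is cancelled using characteristic zero.
  ≋-from-∂ : ∀ {a} {I : Set a} (U V : I → PS K) → (∀ p → U p 0 ≈ V p 0) →
             (∀ n → (∀ p → U p ≋[ n ] V p) → ∀ p → ∂ (U p) n ≈ ∂ (V p) n) → ∀ p → U p ≋ V p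
  ≋-from-∂ U V U₀≈V₀ step p n = agree n p n ℕ.≤-refl
    where
    agree : ∀ n p → U p ≋[ n ] V p
    agree zero    p zero z≤n = U₀≈V₀ p
    agree (suc n) p m m≤1+n with ℕ.m≤n⇒m<n∨m≡n m≤1+n
    ... | inj₁ m<1+n  = agree n p m (ℕ.≤-pred m<1+n)
    ... | inj₂ ≡.refl = *-cancelˡ (charZero n) (step n (agree n) p)

  comp₀-⊛ : ∀ {X} → X 0 ≈ 0# → ∀ f g → comp₀ K (f ⊛ g) X ≋ comp₀ K f X ⊛ comp₀ K g X
  comp₀-⊛ {X} X₀≈0 f g = ≋-from-∂ (λ (f , g) → comp₀ K (f ⊛ g) X) (λ (f , g) → comp₀ K f X ⊛ comp₀ K g X)
                                    base step (f , g)
    where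
    base : ∀ ((f , g) : PS K × PS K) → comp₀ K (f ⊛ g) X 0 ≈ (comp₀ K f X ⊛ comp₀ K g X) 0
    base (f , g) = trans (comp₀-coeff₀ (f ⊛ g) X) (trans (coeff₀-⊛ f g)
      (sym (trans (coeff₀-⊛ (comp₀ K f X) (comp₀ K g X)) (*-cong (comp₀-coeff₀ f X) (comp₀-coeff₀ g X)))))
    step : ∀ n → (∀ ((f , g) : PS K × PS K) → comp₀ K (f ⊛ g) X ≋[ n ] comp₀ K f X ⊛ comp₀ K g X) →
           ∀ ((f , g) : PS K × PS K) → ∂ (comp₀ K (f ⊛ g) X) n ≈ ∂ (comp₀ K f X ⊛ comp₀ K g X) n
    step n ih (f , g) = trans (expand n) (trans (by-ih n ℕ.≤-refl) (sym (product n)))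
      where
      U V U′ V′ : PS K
      U  = comp₀ K f X
      V  = comp₀ K g X
      U′ = comp₀ K (∂ f) X
      V′ = comp₀ K (∂ g) X
      expand : ∂ (comp₀ K (f ⊛ g) X) ≋ (comp₀ K (∂ f ⊛ g) X ⊕ comp₀ K (f ⊛ ∂ g) X) ⊛ ∂ X
      expand = 𝓕.trans (∂-comp₀ X₀≈0 (f ⊛ g))
        (⊛-congʳ (∂ X) (𝓕.trans (comp₀-cong (∂-⊛ f g) 𝓕.refl) (comp₀-⊕ (∂ f ⊛ g) (f ⊛ ∂ g) X)))
      by-ih : (comp₀ K (∂ f ⊛ g) X ⊕ comp₀ K (f ⊛ ∂ g) X) ⊛ ∂ X ≋[ n ] (U′ ⊛ V ⊕ U ⊛ V′) ⊛ ∂ X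
      by-ih = ⊛-cong-≋[] {v = ∂ X} {∂ X} (⊕-cong-≋[] (ih (∂ f , g)) (ih (f , ∂ g))) (λ _ _ → refl)
      product : ∂ (U ⊛ V) ≋ (U′ ⊛ V ⊕ U ⊛ V′) ⊛ ∂ X
      product = 𝓕.begin
        ∂ (U ⊛ V)                                  𝓕.≈⟨ ∂-⊛ U V ⟩
        ∂ U ⊛ V ⊕ U ⊛ ∂ V                          𝓕.≈⟨ 𝓕.+-cong (⊛-congʳ V (∂-comp₀ X₀≈0 f))
                                                                   (⊛-congˡ U (∂-comp₀ X₀≈0 g)) ⟩
        (U′ ⊛ ∂ X) ⊛ V ⊕ U ⊛ (V′ ⊛ ∂ X)            𝓕.≈⟨ 𝓕.+-cong (𝓕.xy∙z≈xz∙y U′ (∂ X) V)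
                                                                   (𝓕.sym (𝓕.*-assoc U V′ (∂ X))) ⟩
        (U′ ⊛ V) ⊛ ∂ X ⊕ (U ⊛ V′) ⊛ ∂ X            𝓕.≈⟨ 𝓕.distribʳ (∂ X) (U′ ⊛ V) (U ⊛ V′) ⟨
        (U′ ⊛ V ⊕ U ⊛ V′) ⊛ ∂ X                    𝓕.∎

  𝕩 : PS K
  𝕩 zero          = 0#
  𝕩 (suc zero)    = 1#
  𝕩 (suc (suc n)) = 0#

  ∂𝕩≋𝟙 : ∂ 𝕩 ≋ 𝟙
  ∂𝕩≋𝟙 zero    = trans (*-identityʳ _) (+-identityʳ 1#)
  ∂𝕩≋𝟙 (suc n) = zeroʳ _

  comp₀-identityʳ : ∀ h → comp₀ K h 𝕩 ≋ h
  comp₀-identityʳ = ≋-from-∂ (λ h → comp₀ K h 𝕩) (λ h → h) (λ h → comp₀-coeff₀ h 𝕩) step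
    where
    step : ∀ n → (∀ h → comp₀ K h 𝕩 ≋[ n ] h) → ∀ h → ∂ (comp₀ K h 𝕩) n ≈ ∂ h n
    step n ih h = begin
      ∂ (comp₀ K h 𝕩) n          ≈⟨ ∂-comp₀ refl h n ⟩
      (comp₀ K (∂ h) 𝕩 ⊛ ∂ 𝕩) n  ≈⟨ ⊛-congˡ (comp₀ K (∂ h) 𝕩) ∂𝕩≋𝟙 n ⟩
      (comp₀ K (∂ h) 𝕩 ⊛ 𝟙) n    ≈⟨ 𝓕.*-identityʳ (comp₀ K (∂ h) 𝕩) n ⟩
      comp₀ K (∂ h) 𝕩 n          ≈⟨ ih (∂ h) n ℕ.≤-refl ⟩
      ∂ h n                      ∎

  comp₀-assoc : ∀ {g X} → g 0 ≈ 0# → X 0 ≈ 0# → ∀ f → comp₀ K (comp₀ K f g) X ≋ comp₀ K f (comp₀ K g X)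
  comp₀-assoc {g} {X} g₀≈0 X₀≈0 =
    ≋-from-∂ (λ f → comp₀ K (comp₀ K f g) X) (λ f → comp₀ K f (comp₀ K g X)) base step
    where
    G : PS K
    G = comp₀ K g X
    base : ∀ f → comp₀ K (comp₀ K f g) X 0 ≈ comp₀ K f G 0
    base f = trans (comp₀-coeff₀ (comp₀ K f g) X) (trans (comp₀-coeff₀ f g) (sym (comp₀-coeff₀ f G)))
    step : ∀ n → (∀ f → comp₀ K (comp₀ K f g) X ≋[ n ] comp₀ K f G) →
           ∀ f → ∂ (comp₀ K (comp₀ K f g) X) n ≈ ∂ (comp₀ K f G) n
    step n ih f = trans (outer n) (trans (by-ih n ℕ.≤-refl) (sym (inner n)))
      where
      outer : ∂ (comp₀ K (comp₀ K f g) X) ≋ (comp₀ K (comp₀ K (∂ f) g) X ⊛ comp₀ K (∂ g) X) ⊛ ∂ X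
      outer = 𝓕.trans (∂-comp₀ X₀≈0 (comp₀ K f g)) (⊛-congʳ (∂ X)
        (𝓕.trans (comp₀-cong (∂-comp₀ g₀≈0 f) 𝓕.refl) (comp₀-⊛ X₀≈0 (comp₀ K (∂ f) g) (∂ g))))
      by-ih : (comp₀ K (comp₀ K (∂ f) g) X ⊛ comp₀ K (∂ g) X) ⊛ ∂ X
                ≋[ n ] (comp₀ K (∂ f) G ⊛ comp₀ K (∂ g) X) ⊛ ∂ X
      by-ih = ⊛-cong-≋[] {v = ∂ X} {∂ X} (⊛-cong-≋[] {v = comp₀ K (∂ g) X} {comp₀ K (∂ g) X}
                (ih (∂ f)) (λ _ _ → refl)) (λ _ _ → refl)
      inner : ∂ (comp₀ K f G) ≋ (comp₀ K (∂ f) G ⊛ comp₀ K (∂ g) X) ⊛ ∂ X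
      inner = 𝓕.trans (∂-comp₀ (trans (comp₀-coeff₀ g X) g₀≈0) f)
        (𝓕.trans (⊛-congˡ (comp₀ K (∂ f) G) (∂-comp₀ X₀≈0 g))
                 (𝓕.sym (𝓕.*-assoc (comp₀ K (∂ f) G) (comp₀ K (∂ g) X) (∂ X))))

  k!⁻¹*kCr≈r!⁻¹*[k∸r]!⁻¹ : ∀ {k r} → r ℕ.≤ k → k !⁻¹ * ι K (k C r) ≈ r !⁻¹ * (k ∸ r) !⁻¹
  k!⁻¹*kCr≈r!⁻¹*[k∸r]!⁻¹ {k} {r} r≤k = *-cancelˡ (ι!≉0 k) (begin
    ι K (k !) * (k !⁻¹ * ι K (k C r))             ≈⟨ *-assoc _ _ _ ⟨
    (ι K (k !) * k !⁻¹) * ι K (k C r)             ≈⟨ trans (*-congʳ (ι!*!⁻¹≈1 k)) (*-identityˡ _) ⟩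
    ι K (k C r)                                   ≈⟨ *-identityʳ _ ⟨
    ι K (k C r) * 1#                              ≈⟨ *-congˡ (*-identityʳ 1#) ⟨
    ι K (k C r) * (1# * 1#)                        ≈⟨ *-congˡ (*-cong (ι!*!⁻¹≈1 r) (ι!*!⁻¹≈1 (k ∸ r))) ⟨
    ι K (k C r) * ((ι K (r !) * r !⁻¹) * (ι K ((k ∸ r) !) * (k ∸ r) !⁻¹))
      ≈⟨ *-congˡ (interchange _ _ _ _) ⟩
    ι K (k C r) * ((ι K (r !) * ι K ((k ∸ r) !)) * (r !⁻¹ * (k ∸ r) !⁻¹))
      ≈⟨ *-assoc _ _ _ ⟨
    (ι K (k C r) * (ι K (r !) * ι K ((k ∸ r) !))) * (r !⁻¹ * (k ∸ r) !⁻¹)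
      ≈⟨ *-congʳ (trans (*-comm _ _) (trans (*-congʳ (sym (ι-* (r !) ((k ∸ r) !))))
                                            (sym (ι-* (r ! ℕ.* (k ∸ r) !) (k C r))))) ⟩
    ι K (r ! ℕ.* (k ∸ r) ! ℕ.* (k C r)) * (r !⁻¹ * (k ∸ r) !⁻¹)
      ≡⟨ ≡.cong (λ m → ι K m * (r !⁻¹ * (k ∸ r) !⁻¹)) (r!*[k∸r]!*kCr≡k! r≤k) ⟩
    ι K (k !) * (r !⁻¹ * (k ∸ r) !⁻¹) ∎)

  powₛ≡^ : ∀ u k → powₛ K u k ≡ u ^ k
  powₛ≡^ u zero    = ≡.refl
  powₛ≡^ u (suc k) = ≡.cong (u ⊛_) (powₛ≡^ u k)

  divided-binomial : ∀ k A B → cst (k !⁻¹) ⊛ powₛ K (A ⊕ B) k ≋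
    Σ< PS-ring (suc k) (λ r → (cst (r !⁻¹) ⊛ powₛ K A r) ⊛ (cst ((k ∸ r) !⁻¹) ⊛ powₛ K B (k ∸ r)))
  divided-binomial k A B = 𝓕.begin
    cst (k !⁻¹) ⊛ powₛ K (A ⊕ B) k
      𝓕.≡⟨ ≡.cong (cst (k !⁻¹) ⊛_) (powₛ≡^ (A ⊕ B) k) ⟩
    cst (k !⁻¹) ⊛ (A ⊕ B) ^ k
      𝓕.≈⟨ ⊛-congˡ (cst (k !⁻¹)) (𝓕.trans (Binomial.theorem 𝓕.commutativeSemiring k A B)
                                            (𝓕.sym (𝓕Σ.Σ<≈sum (suc k) term))) ⟩
    cst (k !⁻¹) ⊛ Σ< PS-ring (suc k) term
      𝓕.≈⟨ 𝓕Σ.*-distribˡ-Σ< (suc k) (cst (k !⁻¹)) term ⟩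
    Σ< PS-ring (suc k) (λ r → cst (k !⁻¹) ⊛ term r)
      𝓕.≈⟨ 𝓕Σ.Σ<-cong (suc k) (λ r r≤k → divide (ℕ.≤-pred r≤k)) ⟩
    Σ< PS-ring (suc k) (λ r → (cst (r !⁻¹) ⊛ powₛ K A r) ⊛ (cst ((k ∸ r) !⁻¹) ⊛ powₛ K B (k ∸ r))) 𝓕.∎
    where
    term : ℕ → PS K
    term r = (k C r) · (A ^ r ⊛ B ^ (k ∸ r))
    divide : ∀ {r} → r ℕ.≤ k →
             cst (k !⁻¹) ⊛ term r ≋ (cst (r !⁻¹) ⊛ powₛ K A r) ⊛ (cst ((k ∸ r) !⁻¹) ⊛ powₛ K B (k ∸ r))
    divide {r} r≤k = 𝓕.begin
      cst (k !⁻¹) ⊛ term r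
        𝓕.≈⟨ ⊛-congˡ (cst (k !⁻¹)) (𝓕.trans (𝓕Σ.·≈ι* (k C r) _)
                                            (⊛-congʳ (A ^ r ⊛ B ^ (k ∸ r)) (ι≋cst (k C r)))) ⟩
      cst (k !⁻¹) ⊛ (cst (ι K (k C r)) ⊛ (A ^ r ⊛ B ^ (k ∸ r)))
        𝓕.≈⟨ 𝓕.*-assoc (cst (k !⁻¹)) (cst (ι K (k C r))) (A ^ r ⊛ B ^ (k ∸ r)) ⟨
      (cst (k !⁻¹) ⊛ cst (ι K (k C r))) ⊛ (A ^ r ⊛ B ^ (k ∸ r))
        𝓕.≈⟨ ⊛-congʳ (A ^ r ⊛ B ^ (k ∸ r)) (𝓕.trans (𝓕.sym (cst-* (k !⁻¹) (ι K (k C r))))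
              (𝓕.trans (cst-cong (k!⁻¹*kCr≈r!⁻¹*[k∸r]!⁻¹ r≤k)) (cst-* (r !⁻¹) ((k ∸ r) !⁻¹)))) ⟩
      (cst (r !⁻¹) ⊛ cst ((k ∸ r) !⁻¹)) ⊛ (A ^ r ⊛ B ^ (k ∸ r))
        𝓕.≈⟨ 𝓕.interchange (cst (r !⁻¹)) (cst ((k ∸ r) !⁻¹)) (A ^ r) (B ^ (k ∸ r)) ⟩
      (cst (r !⁻¹) ⊛ A ^ r) ⊛ (cst ((k ∸ r) !⁻¹) ⊛ B ^ (k ∸ r))
        𝓕.≡⟨ ≡.cong₂ (λ P Q → (cst (r !⁻¹) ⊛ P) ⊛ (cst ((k ∸ r) !⁻¹) ⊛ Q))
                     (≡.sym (powₛ≡^ A r)) (≡.sym (powₛ≡^ B (k ∸ r))) ⟩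
      (cst (r !⁻¹) ⊛ powₛ K A r) ⊛ (cst ((k ∸ r) !⁻¹) ⊛ powₛ K B (k ∸ r)) 𝓕.∎

module Bell {c ℓ : Level} (K : CommutativeRing c ℓ) (F : IsCharZeroField K) where
  open CommutativeRing K hiding (zero)
  open SetoidReasoning setoid
  open Sums K
  open PowerSeries K
  open CharZero K F
  open CommutativeSemigroupProperties *-commutativeSemigroup using (x∙yz≈y∙xz; xy∙z≈y∙xz)
  open CommutativeMonoidSolver *-commutativeMonoid using (solve; _⊜_)
    renaming (_⊕_ to _⊙_)

  egf : (ℕ → Carrier) → PS K
  egf x zero    = 0#
  egf x (suc j) = x (suc j) * suc j !⁻¹

  monomial : ℕ → Carrier → PS K
  monomial p a j = if j ℕ.≡ᵇ p then a else 0#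

  monomial-at : ∀ p a → monomial p a p ≡ a
  monomial-at p a = ≡.cong (λ b → if b then a else 0#) (dec-true (p ℕ.≟ p) ≡.refl)

  monomial-off : ∀ p a {j} → j ≢ p → monomial p a j ≡ 0#
  monomial-off p a {j} j≢p = ≡.cong (λ b → if b then a else 0#) (dec-false (j ℕ.≟ p) j≢p)

  coeff-monomial⊛ : ∀ p a V m → p ≤ m → (monomial p a ⊛ V) m ≈ a * V (m ∸ p)
  coeff-monomial⊛ p a V m p≤m = trans
    (Σ<-single (suc m) p _ (s≤s p≤m) (λ j _ j≢p → trans (*-congʳ (reflexive (monomial-off p a j≢p))) (zeroˡ _)))
    (*-congʳ (reflexive (monomial-at p a)))

  coeff-monomial⊛-< : ∀ p a V m → m < p → (monomial p a ⊛ V) m ≈ 0#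
  coeff-monomial⊛-< p a V m m<p = Σ<-zero (suc m) (λ j j≤m → trans
    (*-congʳ (reflexive (monomial-off p a (ℕ.<⇒≢ (ℕ.≤-<-trans (ℕ.≤-pred j≤m) m<p))))) (zeroˡ _))

  monomial-powₛ : ∀ p a r → powₛ K (monomial p a) r ≋ monomial (r ℕ.* p) (pow K a r)
  monomial-powₛ p a zero    zero    = refl
  monomial-powₛ p a zero    (suc j) = refl
  monomial-powₛ p a (suc r) j       =
    trans (⊛-congˡ (monomial p a) (monomial-powₛ p a r) j) (shift j)
    where
    shift : ∀ j → (monomial p a ⊛ monomial (r ℕ.* p) (pow K a r)) j ≈ monomial (p ℕ.+ r ℕ.* p) (a * pow K a r) j
    shift j with p ℕ.≤? j
    ... | no p≰j = trans (coeff-monomial⊛-< p a (monomial (r ℕ.* p) (pow K a r)) j (ℕ.≰⇒> p≰j))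
      (sym (reflexive (monomial-off _ _ (λ j≡p+rp → p≰j (≡.subst (p ≤_) (≡.sym j≡p+rp) (ℕ.m≤m+n p _))))))
    ... | yes p≤j = begin
      (monomial p a ⊛ monomial (r ℕ.* p) (pow K a r)) j
        ≈⟨ coeff-monomial⊛ p a (monomial (r ℕ.* p) (pow K a r)) j p≤j ⟩
      a * (if j ∸ p ℕ.≡ᵇ r ℕ.* p then pow K a r else 0#)
        ≡⟨ ≡.cong (λ b → a * (if b then pow K a r else 0#))
                  (does-⇔ shifted (j ∸ p ℕ.≟ r ℕ.* p) (j ℕ.≟ p ℕ.+ r ℕ.* p)) ⟩
      a * (if j ℕ.≡ᵇ p ℕ.+ r ℕ.* p then pow K a r else 0#)
        ≈⟨ *-distribˡ-if _ a (pow K a r) ⟩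
      monomial (p ℕ.+ r ℕ.* p) (a * pow K a r) j ∎
      where
      shifted : (j ∸ p ≡ r ℕ.* p) ⇔ (j ≡ p ℕ.+ r ℕ.* p)
      shifted = mk⇔ (λ e → ≡.trans (≡.sym (ℕ.m+[n∸m]≡n p≤j)) (≡.cong (p ℕ.+_) e))
                    (λ e → ≡.trans (≡.cong (_∸ p) e) (ℕ.m+n∸m≡n p (r ℕ.* p)))

  segment : (ℕ → Carrier) → ℕ → ℕ → PS K
  segment c i zero    = 𝟘
  segment c i (suc l) = monomial i (c i) ⊕ segment c (suc i) l

  segment-below : ∀ c l {i j} → j < i → segment c i l j ≈ 0#
  segment-below c zero    {j = j} j<i = 𝟘≈0 j
  segment-below c (suc l) {i} j<i = trans
    (+-cong (reflexive (monomial-off i (c i) (ℕ.<⇒≢ j<i))) (segment-below c l (ℕ.m<n⇒m<1+n j<i)))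
    (+-identityˡ 0#)

  segment-inside : ∀ c l {i j} → i ≤ j → j < i ℕ.+ l → segment c i l j ≈ c j
  segment-inside c zero    {i} i≤j j<i+0 = ⊥-elim (ℕ.<⇒≱ (≡.subst (_ <_) (ℕ.+-identityʳ i) j<i+0) i≤j)
  segment-inside c (suc l) {i} {j} i≤j j<i+1+l with i ℕ.≟ j
  ... | yes ≡.refl =
    trans (+-cong (reflexive (monomial-at i (c i))) (segment-below c l ℕ.≤-refl)) (+-identityʳ _)
  ... | no i≢j     = trans
    (+-cong (reflexive (monomial-off i (c i) (i≢j ∘ ≡.sym)))
            (segment-inside c l (ℕ.≤∧≢⇒< i≤j i≢j) (≡.subst (j <_) (ℕ.+-suc i l) j<i+1+l)))
    (+-identityˡ _)

  segment-egf : ∀ x n → segment (egf x) 1 n ≋[ n ] egf x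
  segment-egf x n zero    _   = segment-below (egf x) n (s≤s z≤n)
  segment-egf x n (suc j) j<n = segment-inside (egf x) n (s≤s z≤n) (s≤s j<n)

  weight : ∀ {l} → ℕ → Vec ℕ l → (ℕ → Carrier) → Carrier
  weight i []       c = 1#
  weight i (r ∷ rs) c = (r !⁻¹ * pow K (c i) r) * weight (suc i) rs c

  multinomialTerm : (ℕ → Carrier) → (i k m : ℕ) → ∀ {l} → Vec ℕ l → Carrier
  multinomialTerm c i k m rs =
    if (rsum K rs ℕ.≡ᵇ k) ∧ (wsum K i rs ℕ.≡ᵇ m) then weight i rs c else 0#

  multinomialSum : (ℕ → Carrier) → (i l b k m : ℕ) → Carrier
  multinomialSum c i l b k m = sumList K (List.map (multinomialTerm c i k m) (vecs K l b))

  sumList-vecs-suc : ∀ l b (f : Vec ℕ (suc l) → Carrier) →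
    sumList K (List.map f (vecs K (suc l) b))
      ≈ Σ< K (suc b) (λ r → sumList K (List.map (f ∘ (r ∷_)) (vecs K l b)))
  sumList-vecs-suc l b f = begin
    sumList K (List.map f (vecs K (suc l) b))
      ≈⟨ sumList-concatMap f (λ rs → List.map (_∷ rs) (upTo (suc b))) (vecs K l b) ⟩
    sumList K (List.map (λ rs → sumList K (List.map f (List.map (_∷ rs) (upTo (suc b))))) (vecs K l b))
      ≈⟨ sumList-cong (vecs K l b) (λ rs → trans
           (reflexive (≡.cong (sumList K) (≡.sym (List.map-∘ (upTo (suc b))))))
           (sumList-applyUpTo (suc b) (λ r → r) (f ∘ (_∷ rs)))) ⟩
    sumList K (List.map (λ rs → Σ< K (suc b) (λ r → f (r ∷ rs))) (vecs K l b))
      ≈⟨ sumList-Σ< (vecs K l b) (suc b) (λ rs r → f (r ∷ rs)) ⟩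
    Σ< K (suc b) (λ r → sumList K (List.map (f ∘ (r ∷_)) (vecs K l b))) ∎

  multinomialTerm-∷ : ∀ c i {k m} r {l} (rs : Vec ℕ l) → r ≤ k → i ℕ.* r ≤ m →
    multinomialTerm c i k m (r ∷ rs)
      ≈ (r !⁻¹ * pow K (c i) r) * multinomialTerm c (suc i) (k ∸ r) (m ∸ i ℕ.* r) rs
  multinomialTerm-∷ c i {k} {m} r rs r≤k ir≤m = begin
    multinomialTerm c i k m (r ∷ rs)
      ≡⟨ ≡.cong₂ (λ b b′ → if b ∧ b′ then weight i (r ∷ rs) c else 0#)
           ([r+s≡ᵇn]≡[s≡ᵇn∸r] r (rsum K rs) r≤k) ([r+s≡ᵇn]≡[s≡ᵇn∸r] (i ℕ.* r) (wsum K (suc i) rs) ir≤m) ⟩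
    (if (rsum K rs ℕ.≡ᵇ k ∸ r) ∧ (wsum K (suc i) rs ℕ.≡ᵇ m ∸ i ℕ.* r) then weight i (r ∷ rs) c else 0#)
      ≈⟨ *-distribˡ-if _ _ _ ⟨
    (r !⁻¹ * pow K (c i) r) * multinomialTerm c (suc i) (k ∸ r) (m ∸ i ℕ.* r) rs ∎

  multinomialTerm-∷-k<r : ∀ c i {k m} r {l} (rs : Vec ℕ l) → k < r → multinomialTerm c i k m (r ∷ rs) ≡ 0#
  multinomialTerm-∷-k<r c i {k} {m} r rs k<r =
    ≡.cong (λ b → if b ∧ (wsum K i (r ∷ rs) ℕ.≡ᵇ m) then weight i (r ∷ rs) c else 0#)
           ([r+s≡ᵇn]≡false r (rsum K rs) k<r)

  multinomialTerm-∷-m<ir : ∀ c i {k m} r {l} (rs : Vec ℕ l) → m < i ℕ.* r →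
                           multinomialTerm c i k m (r ∷ rs) ≡ 0#
  multinomialTerm-∷-m<ir c i {k} {m} r rs m<ir =
    ≡.cong (λ b → if b then weight i (r ∷ rs) c else 0#)
      (≡.trans (≡.cong ((rsum K (r ∷ rs) ℕ.≡ᵇ k) ∧_) ([r+s≡ᵇn]≡false (i ℕ.* r) (wsum K (suc i) rs) m<ir))
               (∧-zeroʳ _))

  multinomial : ∀ c l i b k m → k ≤ b → multinomialSum c i l b k m ≈ k !⁻¹ * powₛ K (segment c i l) k m
  multinomial c zero    i b zero    zero    _ = trans (+-identityʳ 1#) (sym (trans (*-identityʳ _) 0!⁻¹≈1))
  multinomial c zero    i b zero    (suc m) _ = trans (+-identityʳ 0#) (sym (zeroʳ _))
  multinomial c zero    i b (suc k) m       _ =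
    trans (+-identityʳ 0#) (sym (trans (*-congˡ (trans (𝓕.zeroˡ (powₛ K 𝟘 k) m) (𝟘≈0 m))) (zeroʳ _)))
  multinomial c (suc l) i b k m k≤b = begin
    multinomialSum c i (suc l) b k m
      ≈⟨ sumList-vecs-suc l b (multinomialTerm c i k m) ⟩
    Σ< K (suc b) S
      ≈⟨ Σ<-extend (suc b) S (s≤s k≤b) (λ r k<r → sumList-zero (vecs K l b)
           (λ rs → reflexive (multinomialTerm-∷-k<r c i r rs k<r))) ⟩
    Σ< K (suc k) S
      ≈⟨ Σ<-cong (suc k) (λ r r≤k → S≈T r (ℕ.≤-pred r≤k)) ⟩
    Σ< K (suc k) (λ r → T r m)
      ≈⟨ Σ<-coeff (suc k) T m ⟨
    Σ< PS-ring (suc k) T m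
      ≈⟨ divided-binomial k Mᵢ Cᵢ₊₁ m ⟨
    (cst (k !⁻¹) ⊛ powₛ K (Mᵢ ⊕ Cᵢ₊₁) k) m
      ≈⟨ coeff-cst⊛ (k !⁻¹) (powₛ K (Mᵢ ⊕ Cᵢ₊₁) k) m ⟩
    k !⁻¹ * powₛ K (segment c i (suc l)) k m ∎
    where
    Mᵢ Cᵢ₊₁ : PS K
    Mᵢ = monomial i (c i)
    Cᵢ₊₁ = segment c (suc i) l
    S : ℕ → Carrier
    S r = sumList K (List.map (multinomialTerm c i k m ∘ (r ∷_)) (vecs K l b))
    T : ℕ → PS K
    T r = (cst (r !⁻¹) ⊛ powₛ K Mᵢ r) ⊛ (cst ((k ∸ r) !⁻¹) ⊛ powₛ K Cᵢ₊₁ (k ∸ r))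
    T-coeff : ∀ r → T r m ≈ (r !⁻¹ * (k ∸ r) !⁻¹) * (monomial (r ℕ.* i) (pow K (c i) r) ⊛ powₛ K Cᵢ₊₁ (k ∸ r)) m
    T-coeff r = begin
      T r m
        ≈⟨ 𝓕.interchange (cst (r !⁻¹)) (powₛ K Mᵢ r) (cst ((k ∸ r) !⁻¹)) (powₛ K Cᵢ₊₁ (k ∸ r)) m ⟩
      ((cst (r !⁻¹) ⊛ cst ((k ∸ r) !⁻¹)) ⊛ (powₛ K Mᵢ r ⊛ powₛ K Cᵢ₊₁ (k ∸ r))) m
        ≈⟨ ⊛-cong (𝓕.sym (cst-* (r !⁻¹) ((k ∸ r) !⁻¹)))
                  (⊛-congʳ (powₛ K Cᵢ₊₁ (k ∸ r)) (monomial-powₛ i (c i) r)) m ⟩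
      (cst (r !⁻¹ * (k ∸ r) !⁻¹) ⊛ (monomial (r ℕ.* i) (pow K (c i) r) ⊛ powₛ K Cᵢ₊₁ (k ∸ r))) m
        ≈⟨ coeff-cst⊛ (r !⁻¹ * (k ∸ r) !⁻¹) (monomial (r ℕ.* i) (pow K (c i) r) ⊛ powₛ K Cᵢ₊₁ (k ∸ r)) m ⟩
      (r !⁻¹ * (k ∸ r) !⁻¹) * (monomial (r ℕ.* i) (pow K (c i) r) ⊛ powₛ K Cᵢ₊₁ (k ∸ r)) m ∎
    S≈T : ∀ r → r ≤ k → S r ≈ T r m
    S≈T r r≤k with i ℕ.* r ℕ.≤? m
    ... | yes ir≤m = begin
      S r
        ≈⟨ sumList-cong (vecs K l b) (λ rs → multinomialTerm-∷ c i r rs r≤k ir≤m) ⟩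
      sumList K (List.map (λ rs → (r !⁻¹ * pow K (c i) r) * multinomialTerm c (suc i) (k ∸ r) (m ∸ i ℕ.* r) rs)
                          (vecs K l b))
        ≈⟨ *-distribˡ-sumList (vecs K l b) _ _ ⟨
      (r !⁻¹ * pow K (c i) r) * multinomialSum c (suc i) l b (k ∸ r) (m ∸ i ℕ.* r)
        ≈⟨ *-congˡ (multinomial c l (suc i) b (k ∸ r) (m ∸ i ℕ.* r) (ℕ.≤-trans (ℕ.m∸n≤m k r) k≤b)) ⟩
      (r !⁻¹ * pow K (c i) r) * ((k ∸ r) !⁻¹ * powₛ K Cᵢ₊₁ (k ∸ r) (m ∸ i ℕ.* r))
        ≈⟨ rearrange (r !⁻¹) (pow K (c i) r) ((k ∸ r) !⁻¹) _ ⟩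
      (r !⁻¹ * (k ∸ r) !⁻¹) * (pow K (c i) r * powₛ K Cᵢ₊₁ (k ∸ r) (m ∸ i ℕ.* r))
        ≡⟨ ≡.cong (λ j → (r !⁻¹ * (k ∸ r) !⁻¹) * (pow K (c i) r * powₛ K Cᵢ₊₁ (k ∸ r) (m ∸ j))) (ℕ.*-comm i r) ⟩
      (r !⁻¹ * (k ∸ r) !⁻¹) * (pow K (c i) r * powₛ K Cᵢ₊₁ (k ∸ r) (m ∸ r ℕ.* i))
        ≈⟨ *-congˡ (coeff-monomial⊛ (r ℕ.* i) (pow K (c i) r) (powₛ K Cᵢ₊₁ (k ∸ r)) m
                                    (≡.subst (_≤ m) (ℕ.*-comm i r) ir≤m)) ⟨
      (r !⁻¹ * (k ∸ r) !⁻¹) * (monomial (r ℕ.* i) (pow K (c i) r) ⊛ powₛ K Cᵢ₊₁ (k ∸ r)) m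
        ≈⟨ T-coeff r ⟨
      T r m ∎
      where
      rearrange : ∀ a x b y → (a * x) * (b * y) ≈ (a * b) * (x * y)
      rearrange = solve 4 (λ a x b y → (a ⊙ x) ⊙ (b ⊙ y) ⊜ (a ⊙ b) ⊙ (x ⊙ y)) refl
    ... | no ir≰m = trans
      (sumList-zero (vecs K l b) (λ rs → reflexive (multinomialTerm-∷-m<ir c i r rs (ℕ.≰⇒> ir≰m))))
      (sym (trans (T-coeff r) (trans (*-congˡ (coeff-monomial⊛-< (r ℕ.* i) _ (powₛ K Cᵢ₊₁ (k ∸ r)) m
        (≡.subst (m <_) (ℕ.*-comm i r) (ℕ.≰⇒> ir≰m)))) (zeroʳ _))))

  mono≈ι[den]*weight : ∀ j {l} (rs : Vec ℕ l) x →
                       mono K (suc j) rs x ≈ ι K (den K (suc j) rs) * weight (suc j) rs (egf x)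
  mono≈ι[den]*weight j []       x = sym (trans (*-congʳ (+-identityʳ 1#)) (*-identityˡ 1#))
  mono≈ι[den]*weight j (r ∷ rs) x = sym (begin
    ι K (r ! ℕ.* (suc j !) ℕ.^ r ℕ.* den K (suc (suc j)) rs) * ((r !⁻¹ * pow K (x (suc j) * suc j !⁻¹) r) * W)
      ≈⟨ *-cong (trans (ι-* (r ! ℕ.* (suc j !) ℕ.^ r) (den K (suc (suc j)) rs))
                       (*-congʳ (trans (ι-* (r !) ((suc j !) ℕ.^ r)) (*-congˡ (ι-^ (suc j !) r)))))
                (*-congʳ (*-congˡ (pow-distrib-* (x (suc j)) (suc j !⁻¹) r))) ⟩
    ((ι K (r !) * pow K (ι K (suc j !)) r) * ι K (den K (suc (suc j)) rs))
      * ((r !⁻¹ * (pow K (x (suc j)) r * pow K (suc j !⁻¹) r)) * W)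
      ≈⟨ rearrange _ _ _ _ _ _ _ ⟩
    ((ι K (r !) * r !⁻¹) * (pow K (ι K (suc j !)) r * pow K (suc j !⁻¹) r))
      * (pow K (x (suc j)) r * (ι K (den K (suc (suc j)) rs) * W))
      ≈⟨ *-cong (*-cong (ι!*!⁻¹≈1 r) (trans (sym (pow-distrib-* _ _ r))
                (trans (pow-cong r (ι!*!⁻¹≈1 (suc j))) (pow-1# r))))
                (*-congˡ (sym (mono≈ι[den]*weight (suc j) rs x))) ⟩
    (1# * 1#) * (pow K (x (suc j)) r * mono K (suc (suc j)) rs x)
      ≈⟨ trans (*-congʳ (*-identityˡ 1#)) (*-identityˡ _) ⟩
    mono K (suc j) (r ∷ rs) x ∎)
    where
    W : Carrier
    W = weight (suc (suc j)) rs (egf x)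
    rearrange : ∀ a p d a′ y b′ w →
                ((a * p) * d) * ((a′ * (y * b′)) * w) ≈ ((a * a′) * (p * b′)) * (y * (d * w))
    rearrange = solve 7 (λ a p d a′ y b′ w →
      ((a ⊙ p) ⊙ d) ⊙ ((a′ ⊙ (y ⊙ b′)) ⊙ w) ⊜ ((a ⊙ a′) ⊙ (p ⊙ b′)) ⊙ (y ⊙ (d ⊙ w))) refl

  bellSum-summand : ∀ x n k (rs : Vec ℕ n) →
    (if (rsum K rs ℕ.≡ᵇ k) ∧ (wsum K 1 rs ℕ.≡ᵇ n) then ι K (bellCoeff K n rs) * mono K 1 rs x else 0#)
      ≈ ι K (n !) * multinomialTerm (egf x) 1 k n rs
  bellSum-summand x n k rs with rsum K rs ℕ.≡ᵇ k | wsum K 1 rs ℕ.≡ᵇ n | ℕ.≡ᵇ⇒≡ (wsum K 1 rs) n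
  ... | false | _     | _      = sym (zeroʳ _)
  ... | true  | false | _      = sym (zeroʳ _)
  ... | true  | true  | wsum≡n = begin
    ι K (bellCoeff K n rs) * mono K 1 rs x
      ≈⟨ *-congˡ (mono≈ι[den]*weight 0 rs x) ⟩
    ι K (bellCoeff K n rs) * (ι K (den K 1 rs) * weight 1 rs (egf x))
      ≈⟨ trans (sym (*-assoc _ _ _)) (*-congʳ (trans (*-comm _ _) (sym (ι-* (den K 1 rs) _)))) ⟩
    ι K (den K 1 rs ℕ.* bellCoeff K n rs) * weight 1 rs (egf x)
      ≡⟨ ≡.cong (λ m → ι K m * weight 1 rs (egf x)) (den*bellCoeff≡n! K n rs (wsum≡n _)) ⟩
    ι K (n !) * weight 1 rs (egf x) ∎

  B≡bellSum : ∀ {n k} x → k < n → B K n (suc k) x ≡ bellSum K n (suc k) x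
  B≡bellSum {suc n} {k} x (s≤s k≤n) with suc k ℕ.≤ᵇ suc n | ℕ.≤⇒≤ᵇ (s≤s k≤n)
  ... | true | _ = ≡.refl

  k!*B≈n!*egf^k : ∀ x n k → k ≤ n → ι K (k !) * B K n k x ≈ ι K (n !) * powₛ K (egf x) k n
  k!*B≈n!*egf^k x zero    zero    _   = refl
  k!*B≈n!*egf^k x (suc n) zero    _   = trans (zeroʳ _) (sym (zeroʳ _))
  k!*B≈n!*egf^k x n       (suc k) k<n = begin
    ι K (suc k !) * B K n (suc k) x
      ≡⟨ ≡.cong (ι K (suc k !) *_) (B≡bellSum x k<n) ⟩
    ι K (suc k !) * bellSum K n (suc k) x
      ≈⟨ *-congˡ (trans (sumList-cong (vecs K n n) (bellSum-summand x n (suc k)))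
                        (sym (*-distribˡ-sumList (vecs K n n) _ _))) ⟩
    ι K (suc k !) * (ι K (n !) * multinomialSum (egf x) 1 n n (suc k) n)
      ≈⟨ *-congˡ (*-congˡ (multinomial (egf x) n 1 n (suc k) n k<n)) ⟩
    ι K (suc k !) * (ι K (n !) * (suc k !⁻¹ * powₛ K (segment (egf x) 1 n) (suc k) n))
      ≈⟨ rearrange _ _ _ _ ⟩
    ι K (n !) * ((ι K (suc k !) * suc k !⁻¹) * powₛ K (segment (egf x) 1 n) (suc k) n)
      ≈⟨ *-congˡ (trans (*-congʳ (ι!*!⁻¹≈1 (suc k))) (*-identityˡ _)) ⟩
    ι K (n !) * powₛ K (segment (egf x) 1 n) (suc k) n
      ≈⟨ *-congˡ (powₛ-cong-≋[] (suc k) (segment-egf x n) n ℕ.≤-refl) ⟩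
    ι K (n !) * powₛ K (egf x) (suc k) n ∎
    where
    rearrange : ∀ a b c d → a * (b * (c * d)) ≈ b * ((a * c) * d)
    rearrange = solve 4 (λ a b c d → a ⊙ (b ⊙ (c ⊙ d)) ⊜ b ⊙ ((a ⊙ c) ⊙ d)) refl

  Φ≈n!*comp₀-egf : ∀ u x n → Φ K n u x ≈ ι K (n !) * comp₀ K u (egf x) n
  Φ≈n!*comp₀-egf u x n = begin
    Σ< K (suc n) (λ k → Dⁱ K k u 0 * B K n k x)
      ≈⟨ Σ<-cong (suc n) (λ k k≤n → trans (*-congʳ (Dⁱ-at-0 k u))
           (trans (xy∙z≈y∙xz _ _ _) (*-congˡ (k!*B≈n!*egf^k x n k (ℕ.≤-pred k≤n))))) ⟩
    Σ< K (suc n) (λ k → u k * (ι K (n !) * powₛ K (egf x) k n))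
      ≈⟨ trans (Σ<-cong (suc n) (λ k _ → x∙yz≈y∙xz _ _ _)) (sym (*-distribˡ-Σ< (suc n) _ _)) ⟩
    ι K (n !) * comp₀ K u (egf x) n ∎

module FaaDiBruno {c ℓ : Level} (K : CommutativeRing c ℓ) (F : IsCharZeroField K) where
  open CommutativeRing K hiding (zero)
  open SetoidReasoning setoid
  open CommutativeSemigroupProperties *-commutativeSemigroup using (xy∙z≈xz∙y)
  open Sums K
  open PowerSeries K
  open CharZero K F
  open Bell K F

  Φ-cong : ∀ {u v} → u ≋ v → ∀ n x → Φ K n u x ≈ Φ K n v x
  Φ-cong {u} {v} u≋v n x = Σ<-cong (suc n) (λ k _ →
    *-congʳ (trans (Dⁱ-at-0 k u) (trans (*-congˡ (u≋v k)) (sym (Dⁱ-at-0 k v)))))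

  egf-Φ≋comp₀-egf : ∀ g x → egf (λ j → Φ K j g x) ≋ comp₀ K (dropConst g) (egf x)
  egf-Φ≋comp₀-egf g x zero    = sym (comp₀-coeff₀ (dropConst g) (egf x))
  egf-Φ≋comp₀-egf g x (suc j) = begin
    Φ K (suc j) g x * suc j !⁻¹                                ≈⟨ *-congʳ (Φ≈n!*comp₀-egf g x (suc j)) ⟩
    (ι K (suc j !) * comp₀ K g (egf x) (suc j)) * suc j !⁻¹    ≈⟨ xy∙z≈xz∙y _ _ _ ⟩
    (ι K (suc j !) * suc j !⁻¹) * comp₀ K g (egf x) (suc j)    ≈⟨ *-congʳ (ι!*!⁻¹≈1 (suc j)) ⟩
    1# * comp₀ K g (egf x) (suc j)                             ≈⟨ *-identityˡ _ ⟩
    comp₀ K g (egf x) (suc j)                                  ≈⟨ comp₀-dropConst g (egf x) j ⟩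
    comp₀ K (dropConst g) (egf x) (suc j)                      ∎

  Φ-comp₀-dropConst : ∀ f g n x → Φ K n (comp₀ K f (dropConst g)) x ≈ Φ K n f (λ j → Φ K j g x)
  Φ-comp₀-dropConst f g n x = begin
    Φ K n (comp₀ K f (dropConst g)) x                      ≈⟨ Φ≈n!*comp₀-egf _ x n ⟩
    ι K (n !) * comp₀ K (comp₀ K f (dropConst g)) (egf x) n ≈⟨ *-congˡ (comp₀-assoc refl refl f n) ⟩
    ι K (n !) * comp₀ K f (comp₀ K (dropConst g) (egf x)) n
      ≈⟨ *-congˡ (comp₀-cong {f} (λ _ → refl) (egf-Φ≋comp₀-egf g x) n) ⟨
    ι K (n !) * comp₀ K f (egf (λ j → Φ K j g x)) n         ≈⟨ Φ≈n!*comp₀-egf f _ n ⟨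
    Φ K n f (λ j → Φ K j g x)                              ∎

  Φ-comp₀ : ∀ f g → g 0 ≈ 0# → ∀ n x → Φ K n (comp₀ K f g) x ≈ Φ K n f (λ j → Φ K j g x)
  Φ-comp₀ f g g₀≈0 n x =
    trans (Φ-cong (comp₀-cong {f} (λ _ → refl) g≋dropConst-g) n x) (Φ-comp₀-dropConst f g n x)
    where
    g≋dropConst-g : g ≋ dropConst g
    g≋dropConst-g zero    = g₀≈0
    g≋dropConst-g (suc n) = refl

  e₁ : ℕ → Carrier
  e₁ (suc zero) = 1#
  e₁ _          = 0#

  egf-e₁ : egf e₁ ≋ 𝕩
  egf-e₁ zero          = refl
  egf-e₁ (suc zero)    = trans (*-identityˡ _) 0!⁻¹≈1
  egf-e₁ (suc (suc j)) = zeroˡ _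

  Φ-at-e₁ : ∀ h n → Φ K n h e₁ ≈ ι K (n !) * h n
  Φ-at-e₁ h n = trans (Φ≈n!*comp₀-egf h e₁ n)
    (*-congˡ (trans (comp₀-cong {h} (λ _ → refl) egf-e₁ n) (comp₀-identityʳ h n)))

  ≋⇔Φ≈ₚ : ∀ h u (P : ℕ → Poly K) → (∀ n → _≈ₚ_ K (Φ K n u) (P n)) →
          (h ≋ u ⇔ (∀ n → _≈ₚ_ K (Φ K n h) (P n)))
  ≋⇔Φ≈ₚ h u P Φu≈P = mk⇔
    (λ h≋u n x → trans (Φ-cong h≋u n x) (Φu≈P n x))
    (λ Φh≈P n → *-cancelˡ (ι!≉0 n) (begin
      ι K (n !) * h n   ≈⟨ Φ-at-e₁ h n ⟨
      Φ K n h e₁        ≈⟨ Φh≈P n e₁ ⟩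
      P n e₁            ≈⟨ Φu≈P n e₁ ⟨
      Φ K n u e₁        ≈⟨ Φ-at-e₁ u n ⟩
      ι K (n !) * u n   ∎))

module _ {a b s} {A : Set a} {B : Set b} {S : Set s} (next : S → S) (step : S → A → B → B) (nil : B) where

  Folds : (S → List A → B) → Set (a ⊔ b ⊔ s)
  Folds F = (∀ s → F s [] ≡ nil) × (∀ s x xs → F s (x ∷ xs) ≡ step s x (F (next s) xs))

  folds-unique : ∀ {F G} → Folds F → Folds G → ∀ s xs → F s xs ≡ G s xs
  folds-unique         (F[] , F∷) (G[] , G∷) s []       = ≡.trans (F[] s) (≡.sym (G[] s))
  folds-unique {F} {G} (F[] , F∷) (G[] , G∷) s (x ∷ xs) = ≡.trans (F∷ s x xs)
    (≡.trans (≡.cong (step s x) (folds-unique {F} {G} (F[] , F∷) (G[] , G∷) (next s) xs)) (≡.sym (G∷ s x xs)))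

mapFrom : ∀ {a b} {A : Set a} {B : Set b} → (ℕ → A → B) → ℕ → List A → List B
mapFrom h m []       = []
mapFrom h m (x ∷ xs) = h m x ∷ mapFrom h (suc m) xs

mapFrom-folds : ∀ {a b} {A : Set a} {B : Set b} (h : ℕ → A → B) {F} →
                Folds suc (λ m x r → h m x ∷ r) [] F → ∀ m xs → F m xs ≡ mapFrom h m xs
mapFrom-folds h {F} F-folds =
  folds-unique suc (λ m x r → h m x ∷ r) [] {F} {mapFrom h} F-folds ((λ _ → ≡.refl) , (λ _ _ _ → ≡.refl))

module Horner {c ℓ r ℓr : Level} (K : CommutativeRing c ℓ) (R : CommutativeRing r ℓr)
              (emb : CommutativeRing.Carrier K → CommutativeRing.Carrier R) where
  private module K = CommutativeRing K
  open CommutativeRing R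
  open SetoidReasoning setoid

  accumulate : Carrier → Carrier → List K.Carrier → Carrier
  accumulate y acc []       = 0#
  accumulate y acc (x ∷ xs) = emb x * acc + accumulate y (acc * y) xs

  accumulate-folds : ∀ y {F} → Folds (_* y) (λ acc x r → emb x * acc + r) 0# F →
                     ∀ acc xs → F acc xs ≡ accumulate y acc xs
  accumulate-folds y {F} F-folds =
    folds-unique (_* y) (λ acc x r → emb x * acc + r) 0# {F} {accumulate y} F-folds
                 ((λ _ → ≡.refl) , (λ _ _ _ → ≡.refl))

  -- The helpers goP and goN of evalL are local to Defs and cannot be named. They are
  -- identified with accumulate by folds-unique, leaving their name to unification; this
  -- needs them applied to fresh variables, hence the with-abstractions before the
  -- arguments are bound (v * v is the accumulator of goN after one step).
  evalL[]≡ : ∀ y v o ps → evalL K _+_ _*_ 0# o emb (laurent ps []) y v ≡ accumulate y o ps + 0#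
  evalL[]≡ y v with accumulate-folds y {F = _} ((λ _ → ≡.refl) , (λ _ _ _ → ≡.refl))
  ... | pos = λ o ps → ≡.cong (_+ 0#) (pos o ps)

  evalL∷≡ : ∀ y v o ps b bs →
    evalL K _+_ _*_ 0# o emb (laurent ps (b ∷ bs)) y v
      ≡ accumulate y o ps + (emb b * v + accumulate v (v * v) bs)
  evalL∷≡ y v with (λ b bs → accumulate-folds y {F = _} ((λ _ → ≡.refl) , (λ _ _ _ → ≡.refl)))
                | (λ o ps b → accumulate-folds v {F = _} ((λ _ → ≡.refl) , (λ _ _ _ → ≡.refl)))
                | v * v
  ... | pos | neg | v² = λ o ps b bs → ≡.cong₂ _+_ (pos b bs o ps) (≡.cong (emb b * v +_) (neg o ps b v² bs))

  evalL≡accumulate : ∀ y v o ps ns →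
    evalL K _+_ _*_ 0# o emb (laurent ps ns) y v ≡ accumulate y o ps + accumulate v v ns
  evalL≡accumulate y v o ps []       = evalL[]≡ y v o ps
  evalL≡accumulate y v o ps (b ∷ bs) = evalL∷≡ y v o ps b bs

  horner : Carrier → List K.Carrier → Carrier
  horner y []       = 0#
  horner y (x ∷ xs) = emb x + y * horner y xs

  accumulate≈*horner : ∀ y acc xs → accumulate y acc xs ≈ acc * horner y xs
  accumulate≈*horner y acc []       = sym (zeroʳ acc)
  accumulate≈*horner y acc (x ∷ xs) = begin
    emb x * acc + accumulate y (acc * y) xs   ≈⟨ +-congˡ (accumulate≈*horner y (acc * y) xs) ⟩
    emb x * acc + (acc * y) * horner y xs     ≈⟨ +-cong (*-comm _ _) (*-assoc _ _ _) ⟩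
    acc * emb x + acc * (y * horner y xs)     ≈⟨ distribˡ _ _ _ ⟨
    acc * horner y (x ∷ xs)                   ∎

  evalL≈horner : ∀ y v ps ns → evalL K _+_ _*_ 0# 1# emb (laurent ps ns) y v ≈ horner y ps + v * horner v ns
  evalL≈horner y v ps ns = trans (reflexive (evalL≡accumulate y v 1# ps ns))
    (+-cong (trans (accumulate≈*horner y 1# ps) (*-identityˡ _)) (accumulate≈*horner v v ns))

  horner-cong : ∀ {y y′} xs → y ≈ y′ → horner y xs ≈ horner y′ xs
  horner-cong []       y≈y′ = refl
  horner-cong (x ∷ xs) y≈y′ = +-congˡ (*-cong y≈y′ (horner-cong xs y≈y′))

module LaurentDerivative {c ℓ : Level} (K : CommutativeRing c ℓ) where
  open CommutativeRing K using (Carrier; _*_; -_; 0#)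

  scale negScale : ℕ → Carrier → Carrier
  scale    m a = ι K m * a
  negScale m a = - (ι K m * a)

  derivPos : List Carrier → List Carrier
  derivPos []       = []
  derivPos (a ∷ as) = mapFrom scale 1 as

  derivL : Laurent K → Laurent K
  derivL (laurent ps ns) = laurent (derivPos ps) (0# ∷ mapFrom negScale 1 ns)

  -- As in Horner: the local helpers dPfrom and dN of DL are found by unification, once
  -- their starting index 1 is abstracted.
  DL[]≡ : ∀ ns → DL K (laurent [] ns) ≡ derivL (laurent [] ns)
  DL[]≡ with mapFrom-folds negScale {F = _} ((λ _ → ≡.refl) , (λ _ _ _ → ≡.refl)) | 1
  ... | neg | m = λ ns → ≡.cong (λ t → laurent [] (0# ∷ t)) (neg m ns)

  DL∷≡ : ∀ a as ns → DL K (laurent (a ∷ as) ns) ≡ derivL (laurent (a ∷ as) ns)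
  DL∷≡ with (λ a ns → mapFrom-folds scale {F = _} ((λ _ → ≡.refl) , (λ _ _ _ → ≡.refl)))
          | (λ a as → mapFrom-folds negScale {F = _} ((λ _ → ≡.refl) , (λ _ _ _ → ≡.refl)))
          | 1
  ... | pos | neg | m = λ a as ns → ≡.cong₂ laurent (pos a ns m as) (≡.cong (0# ∷_) (neg a as m ns))

  DL≡derivL : ∀ f → DL K f ≡ derivL f
  DL≡derivL (laurent []       ns) = DL[]≡ ns
  DL≡derivL (laurent (a ∷ as) ns) = DL∷≡ a as ns

  DLⁱ-suc : ∀ k f → DLⁱ K (suc k) f ≡ DLⁱ K k (DL K f)
  DLⁱ-suc zero    f = ≡.refl
  DLⁱ-suc (suc k) f = ≡.cong (DL K) (DLⁱ-suc k f)

module HornerDerivative {c ℓ : Level} (K : CommutativeRing c ℓ) where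
  open CommutativeRing K hiding (zero)
  open PowerSeries K
  open LaurentDerivative K
  open Horner K PS-ring cst using (horner)
  open RingSolver 𝓕.commutativeSemiring using (solve; _:=_; _:+_; _:*_; con)
  open RingProperties 𝓕.ring using (-‿distribʳ-*)
  open AbelianGroupProperties 𝓕.+-abelianGroup using (⁻¹-∙-comm; ε⁻¹≈ε)

  horner-scale-∂ : ∀ m y as →
    horner y (mapFrom scale m as) ⊛ ∂ y ≋ cst (ι K m) ⊛ (horner y as ⊛ ∂ y) ⊕ y ⊛ ∂ (horner y as)
  horner-scale-∂ m y []       = 𝓕.trans (𝓕.zeroˡ (∂ y)) (𝓕.sym (𝓕.trans
    (𝓕.+-cong (𝓕.trans (⊛-congˡ (cst (ι K m)) (𝓕.zeroˡ (∂ y))) (𝓕.zeroʳ _))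
              (𝓕.trans (⊛-congˡ y (∂-cst 0#)) (𝓕.zeroʳ y)))
    (𝓕.+-identityˡ 𝟘)))
  horner-scale-∂ m y (a ∷ as) = 𝓕.begin
    (cst (ι K m * a) ⊕ y ⊛ T) ⊛ ∂ y
      𝓕.≈⟨ ⊛-congʳ (∂ y) (⊕-congʳ (y ⊛ T) (cst-* (ι K m) a)) ⟩
    (M ⊛ A ⊕ y ⊛ T) ⊛ ∂ y
      𝓕.≈⟨ 𝓕.trans (𝓕.distribʳ (∂ y) (M ⊛ A) (y ⊛ T)) (⊕-congˡ ((M ⊛ A) ⊛ ∂ y) (𝓕.*-assoc y T (∂ y))) ⟩
    (M ⊛ A) ⊛ ∂ y ⊕ y ⊛ (T ⊛ ∂ y)
      𝓕.≈⟨ ⊕-congˡ ((M ⊛ A) ⊛ ∂ y) (⊛-congˡ y (𝓕.trans (horner-scale-∂ (suc m) y as)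
             (⊕-congʳ (y ⊛ ∂ H) (⊛-congʳ (H ⊛ ∂ y) (cst-+ 1# (ι K m)))))) ⟩
    (M ⊛ A) ⊛ ∂ y ⊕ y ⊛ ((𝟙 ⊕ M) ⊛ (H ⊛ ∂ y) ⊕ y ⊛ ∂ H)
      𝓕.≈⟨ regroup M A y H (∂ y) (∂ H) ⟩
    M ⊛ ((A ⊕ y ⊛ H) ⊛ ∂ y) ⊕ y ⊛ (∂ y ⊛ H ⊕ y ⊛ ∂ H)
      𝓕.≈⟨ ⊕-congˡ (M ⊛ ((A ⊕ y ⊛ H) ⊛ ∂ y)) (⊛-congˡ y (𝓕.sym ∂[A⊕y⊛H])) ⟩
    M ⊛ ((A ⊕ y ⊛ H) ⊛ ∂ y) ⊕ y ⊛ ∂ (A ⊕ y ⊛ H) 𝓕.∎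
    where
    M A H T : PS K
    M = cst (ι K m)
    A = cst a
    H = horner y as
    T = horner y (mapFrom scale (suc m) as)
    ∂[A⊕y⊛H] : ∂ (A ⊕ y ⊛ H) ≋ ∂ y ⊛ H ⊕ y ⊛ ∂ H
    ∂[A⊕y⊛H] = 𝓕.trans (∂-⊕ A (y ⊛ H)) (𝓕.trans (⊕-congʳ (∂ (y ⊛ H)) (∂-cst a))
                 (𝓕.trans (𝓕.+-identityˡ (∂ (y ⊛ H))) (∂-⊛ y H)))
    regroup : ∀ M A y H D E →
      (M ⊛ A) ⊛ D ⊕ y ⊛ ((𝟙 ⊕ M) ⊛ (H ⊛ D) ⊕ y ⊛ E) ≋ M ⊛ ((A ⊕ y ⊛ H) ⊛ D) ⊕ y ⊛ (D ⊛ H ⊕ y ⊛ E)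
    regroup = solve 6 (λ M A y H D E →
      (M :* A) :* D :+ y :* ((con 1 :+ M) :* (H :* D) :+ y :* E)
        := M :* ((A :+ y :* H) :* D) :+ y :* (D :* H :+ y :* E)) 𝓕.refl

  ∂[y⊛horner] : ∀ y as → ∂ (y ⊛ horner y as) ≋ horner y (mapFrom scale 1 as) ⊛ ∂ y
  ∂[y⊛horner] y as = 𝓕.begin
    ∂ (y ⊛ H)                            𝓕.≈⟨ ∂-⊛ y H ⟩
    ∂ y ⊛ H ⊕ y ⊛ ∂ H                    𝓕.≈⟨ ⊕-congʳ (y ⊛ ∂ H) (𝓕.*-comm (∂ y) H) ⟩
    H ⊛ ∂ y ⊕ y ⊛ ∂ H                    𝓕.≈⟨ ⊕-congʳ (y ⊛ ∂ H) (𝓕.*-identityˡ (H ⊛ ∂ y)) ⟨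
    𝟙 ⊛ (H ⊛ ∂ y) ⊕ y ⊛ ∂ H              𝓕.≈⟨ ⊕-congʳ (y ⊛ ∂ H)
                                               (⊛-congʳ (H ⊛ ∂ y) (cst-cong (+-identityʳ 1#))) ⟨
    cst (ι K 1) ⊛ (H ⊛ ∂ y) ⊕ y ⊛ ∂ H    𝓕.≈⟨ horner-scale-∂ 1 y as ⟨
    horner y (mapFrom scale 1 as) ⊛ ∂ y  𝓕.∎
    where
    H : PS K
    H = horner y as

  ∂-horner : ∀ y ps → ∂ (horner y ps) ≋ horner y (derivPos ps) ⊛ ∂ y
  ∂-horner y []       = 𝓕.trans (∂-cst 0#) (𝓕.sym (𝓕.zeroˡ (∂ y)))
  ∂-horner y (a ∷ as) = 𝓕.trans (∂-⊕ (cst a) (y ⊛ horner y as))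
    (𝓕.trans (⊕-congʳ (∂ (y ⊛ horner y as)) (∂-cst a))
    (𝓕.trans (𝓕.+-identityˡ _) (∂[y⊛horner] y as)))

  horner-negScale : ∀ m y as → horner y (mapFrom negScale m as) ≋ ⊖ horner y (mapFrom scale m as)
  horner-negScale m y []       = 𝓕.sym ε⁻¹≈ε
  horner-negScale m y (a ∷ as) = 𝓕.trans
    (𝓕.+-cong (cst-neg (ι K m * a)) (𝓕.trans (⊛-congˡ y (horner-negScale (suc m) y as))
                                              (𝓕.sym (-‿distribʳ-* y (horner y (mapFrom scale (suc m) as))))))
    (⁻¹-∙-comm (cst (ι K m * a)) (y ⊛ horner y (mapFrom scale (suc m) as)))

module LaurentComposition {c ℓ : Level} (K : CommutativeRing c ℓ) (F : IsCharZeroField K)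
                          (g : PS K) (g₀≉0 : ¬ (CommutativeRing._≈_ K (g 0) (CommutativeRing.0# K))) where
  open CommutativeRing K hiding (zero)
  open IsCharZeroField F
  open SetoidReasoning setoid
  open CommutativeSemigroupProperties *-commutativeSemigroup using (x∙yz≈y∙xz)
  open Sums K
  open PowerSeries K
  open CharZero K F
  open FaaDiBruno K F
  open LaurentDerivative K
  open HornerDerivative K
  module H𝓕 = Horner K PS-ring cst
  module H𝕂 = Horner K K id
  open H𝓕 using (horner)
  open RingProperties 𝓕.ring using (-‿distribˡ-*; -‿distribʳ-*)
  open GroupProperties 𝓕.+-group using (inverseʳ-unique)
  open CommutativeMonoidSolver 𝓕.*-commutativeMonoid using (solve; _⊜_) renaming (_⊕_ to _⊙_)
  open RingSolver 𝓕.commutativeSemiring using ()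
    renaming (solve to solveᵣ; _:=_ to _:=ᵣ_; _:+_ to _:+ᵣ_; _:*_ to _:*ᵣ_)

  w : PS K
  w = invₛ K F g

  lookup-invVec : ∀ n (i : Fin (suc n)) → Vec.lookup (invVec K F g n) i ≡ w (n ∸ Fin.toℕ i)
  lookup-invVec zero    Fin.zero    = ≡.refl
  lookup-invVec (suc n) Fin.zero    = ≡.refl
  lookup-invVec (suc n) (Fin.suc i) = lookup-invVec n i

  g⊛w≋𝟙 : g ⊛ w ≋ 𝟙
  g⊛w≋𝟙 zero    = trans (+-identityˡ _) (⁻¹-inverse (g 0) g₀≉0)
  g⊛w≋𝟙 (suc n) = begin
    Σ< K (suc (suc n)) (λ i → g i * w (suc n ∸ i))   ≈⟨ Σ<-suc (suc n) _ ⟩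
    g 0 * w (suc n) + T                              ≈⟨ +-congʳ g₀*w[1+n]≈-T ⟩
    - T + T                                          ≈⟨ -‿inverseˡ T ⟩
    0#                                               ∎
    where
    open RingProperties ring using () renaming (-‿distribʳ-* to -‿distribʳ-*ₖ)
    S T : Carrier
    S = sumList K (Vec.toList (Vec.tabulate (λ (i : Fin (suc n)) →
          g (suc (Fin.toℕ i)) * Vec.lookup (invVec K F g n) i)))
    T = Σ< K (suc n) (λ i → g (suc i) * w (n ∸ i))
    g₀*w[1+n]≈-T : g 0 * w (suc n) ≈ - T
    g₀*w[1+n]≈-T = begin
      g 0 * - (g 0 ⁻¹ * S)     ≈⟨ -‿distribʳ-*ₖ (g 0) (g 0 ⁻¹ * S) ⟨
      - (g 0 * (g 0 ⁻¹ * S))   ≈⟨ -‿cong (*-assoc _ _ _) ⟨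
      - ((g 0 * g 0 ⁻¹) * S)   ≈⟨ -‿cong (trans (*-congʳ (⁻¹-inverse (g 0) g₀≉0)) (*-identityˡ S)) ⟩
      - S                      ≈⟨ -‿cong (sumList-tabulate (suc n) _ _ (λ i → *-congˡ (reflexive (lookup-invVec n i)))) ⟩
      - T                      ∎

  ∂w≋-w²∂g : ∂ w ≋ ⊖ ((w ⊛ w) ⊛ ∂ g)
  ∂w≋-w²∂g = inverseʳ-unique ((w ⊛ w) ⊛ ∂ g) (∂ w) (𝓕.begin
    (w ⊛ w) ⊛ ∂ g ⊕ ∂ w                   𝓕.≈⟨ ⊕-congˡ ((w ⊛ w) ⊛ ∂ g) (𝓕.*-identityˡ (∂ w)) ⟨
    (w ⊛ w) ⊛ ∂ g ⊕ 𝟙 ⊛ ∂ w               𝓕.≈⟨ ⊕-congˡ ((w ⊛ w) ⊛ ∂ g)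
                                                (⊛-congʳ (∂ w) (𝓕.trans (𝓕.*-comm w g) g⊛w≋𝟙)) ⟨
    (w ⊛ w) ⊛ ∂ g ⊕ (w ⊛ g) ⊛ ∂ w         𝓕.≈⟨ factor w (∂ g) g (∂ w) ⟩
    w ⊛ (∂ g ⊛ w ⊕ g ⊛ ∂ w)               𝓕.≈⟨ ⊛-congˡ w (𝓕.trans (𝓕.sym (∂-⊛ g w))
                                                (𝓕.trans (∂-cong g⊛w≋𝟙) (∂-cst 1#))) ⟩
    w ⊛ 𝟘                                 𝓕.≈⟨ 𝓕.zeroʳ w ⟩
    𝟘                                     𝓕.∎)
    where
    factor : ∀ w d g e → (w ⊛ w) ⊛ d ⊕ (w ⊛ g) ⊛ e ≋ w ⊛ (d ⊛ w ⊕ g ⊛ e)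
    factor = solveᵣ 4 (λ w d g e → (w :*ᵣ w) :*ᵣ d :+ᵣ (w :*ᵣ g) :*ᵣ e :=ᵣ w :*ᵣ (d :*ᵣ w :+ᵣ g :*ᵣ e)) 𝓕.refl

  comp₁≋horner : ∀ ps ns → comp₁ K F (laurent ps ns) g ≋ horner g ps ⊕ w ⊛ horner w ns
  comp₁≋horner ps ns = H𝓕.evalL≈horner g w ps ns

  ∂[w⊛horner] : ∀ ns → ∂ (w ⊛ horner w ns) ≋ (w ⊛ horner w (0# ∷ mapFrom negScale 1 ns)) ⊛ ∂ g
  ∂[w⊛horner] ns = 𝓕.begin
    ∂ (w ⊛ horner w ns)                        𝓕.≈⟨ ∂[y⊛horner] w ns ⟩
    Q ⊛ ∂ w                                    𝓕.≈⟨ ⊛-congˡ Q ∂w≋-w²∂g ⟩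
    Q ⊛ ⊖ ((w ⊛ w) ⊛ ∂ g)                      𝓕.≈⟨ -‿distribʳ-* Q ((w ⊛ w) ⊛ ∂ g) ⟨
    ⊖ (Q ⊛ ((w ⊛ w) ⊛ ∂ g))                    𝓕.≈⟨ 𝓕.-‿cong (rearrange Q w (∂ g)) ⟩
    ⊖ ((w ⊛ (w ⊛ Q)) ⊛ ∂ g)                    𝓕.≈⟨ -‿distribˡ-* (w ⊛ (w ⊛ Q)) (∂ g) ⟩
    ⊖ (w ⊛ (w ⊛ Q)) ⊛ ∂ g                      𝓕.≈⟨ ⊛-congʳ (∂ g) (𝓕.trans (-‿distribʳ-* w (w ⊛ Q))
                                                     (⊛-congˡ w (-‿distribʳ-* w Q))) ⟩
    (w ⊛ (w ⊛ ⊖ Q)) ⊛ ∂ g                      𝓕.≈⟨ ⊛-congʳ (∂ g) (⊛-congˡ w (𝓕.sym (𝓕.trans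
                                                     (⊕-congˡ 𝟘 (⊛-congˡ w (horner-negScale 1 w ns)))
                                                     (𝓕.+-identityˡ (w ⊛ ⊖ Q))))) ⟩
    (w ⊛ horner w (0# ∷ mapFrom negScale 1 ns)) ⊛ ∂ g 𝓕.∎
    where
    Q : PS K
    Q = horner w (mapFrom scale 1 ns)
    rearrange : ∀ Q w d → Q ⊛ ((w ⊛ w) ⊛ d) ≋ (w ⊛ (w ⊛ Q)) ⊛ d
    rearrange = solve 3 (λ Q w d → Q ⊙ ((w ⊙ w) ⊙ d) ⊜ (w ⊙ (w ⊙ Q)) ⊙ d) 𝓕.refl

  ∂-comp₁ : ∀ f → ∂ (comp₁ K F f g) ≋ comp₁ K F (DL K f) g ⊛ ∂ g
  ∂-comp₁ f@(laurent ps ns) = 𝓕.begin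
    ∂ (comp₁ K F f g)                                       𝓕.≈⟨ ∂-cong (comp₁≋horner ps ns) ⟩
    ∂ (horner g ps ⊕ w ⊛ horner w ns)                       𝓕.≈⟨ ∂-⊕ (horner g ps) (w ⊛ horner w ns) ⟩
    ∂ (horner g ps) ⊕ ∂ (w ⊛ horner w ns)                   𝓕.≈⟨ 𝓕.+-cong (∂-horner g ps) (∂[w⊛horner] ns) ⟩
    horner g (derivPos ps) ⊛ ∂ g ⊕ (w ⊛ horner w N) ⊛ ∂ g
      𝓕.≈⟨ 𝓕.distribʳ (∂ g) (horner g (derivPos ps)) (w ⊛ horner w N) ⟨
    (horner g (derivPos ps) ⊕ w ⊛ horner w N) ⊛ ∂ g         𝓕.≈⟨ ⊛-congʳ (∂ g) (comp₁≋horner (derivPos ps) N) ⟨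
    comp₁ K F (derivL f) g ⊛ ∂ g
      𝓕.≡⟨ ≡.cong (λ f′ → comp₁ K F f′ g ⊛ ∂ g) (DL≡derivL f) ⟨
    comp₁ K F (DL K f) g ⊛ ∂ g                              𝓕.∎
    where
    N : List Carrier
    N = 0# ∷ mapFrom negScale 1 ns

  evalK-cong : ∀ f {y y′} → ¬ (y ≈ 0#) → y ≈ y′ → evalK K F f y ≈ evalK K F f y′
  evalK-cong (laurent ps ns) {y} {y′} y≉0 y≈y′ = begin
    evalK K F (laurent ps ns) y                       ≈⟨ H𝕂.evalL≈horner y (y ⁻¹) ps ns ⟩
    H𝕂.horner y ps + y ⁻¹ * H𝕂.horner (y ⁻¹) ns       ≈⟨ +-cong (H𝕂.horner-cong ps y≈y′)
                                                           (*-cong y⁻¹≈y′⁻¹ (H𝕂.horner-cong ns y⁻¹≈y′⁻¹)) ⟩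
    H𝕂.horner y′ ps + y′ ⁻¹ * H𝕂.horner (y′ ⁻¹) ns    ≈⟨ H𝕂.evalL≈horner y′ (y′ ⁻¹) ps ns ⟨
    evalK K F (laurent ps ns) y′                      ∎
    where
    y⁻¹≈y′⁻¹ : y ⁻¹ ≈ y′ ⁻¹
    y⁻¹≈y′⁻¹ = ⁻¹-cong y≉0 y≈y′

  horner-coeff₀ : ∀ y xs → horner y xs 0 ≈ H𝕂.horner (y 0) xs
  horner-coeff₀ y []       = refl
  horner-coeff₀ y (x ∷ xs) = +-congˡ (trans (coeff₀-⊛ y (horner y xs)) (*-congˡ (horner-coeff₀ y xs)))

  comp₁-coeff₀ : ∀ f → comp₁ K F f g 0 ≈ evalK K F f (g 0)
  comp₁-coeff₀ (laurent ps ns) = begin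
    comp₁ K F (laurent ps ns) g 0
      ≈⟨ comp₁≋horner ps ns 0 ⟩
    horner g ps 0 + (w ⊛ horner w ns) 0
      ≈⟨ +-cong (horner-coeff₀ g ps) (trans (coeff₀-⊛ w (horner w ns)) (*-congˡ (horner-coeff₀ w ns))) ⟩
    H𝕂.horner (g 0) ps + g 0 ⁻¹ * H𝕂.horner (g 0 ⁻¹) ns
      ≈⟨ H𝕂.evalL≈horner (g 0) (g 0 ⁻¹) ps ns ⟨
    evalK K F (laurent ps ns) (g 0) ∎

  taylor : Laurent K → PS K
  taylor f k = evalK K F (DLⁱ K k f) (g 0) * k !⁻¹

  ∂-taylor : ∀ f → ∂ (taylor f) ≋ taylor (DL K f)
  ∂-taylor f k = trans (x∙yz≈y∙xz _ _ _)
    (*-cong (reflexive (≡.cong (λ f′ → evalK K F f′ (g 0)) (DLⁱ-suc k f))) (ι[1+k]*[1+k]!⁻¹≈k!⁻¹ k))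

  comp₁≋comp₀-taylor : ∀ f → comp₁ K F f g ≋ comp₀ K (taylor f) (dropConst g)
  comp₁≋comp₀-taylor = ≋-from-∂ (λ f → comp₁ K F f g) (λ f → comp₀ K (taylor f) (dropConst g)) base step
    where
    base : ∀ f → comp₁ K F f g 0 ≈ comp₀ K (taylor f) (dropConst g) 0
    base f = trans (comp₁-coeff₀ f) (sym (trans (comp₀-coeff₀ (taylor f) (dropConst g))
                                               (trans (*-congˡ 0!⁻¹≈1) (*-identityʳ _))))
    step : ∀ n → (∀ f → comp₁ K F f g ≋[ n ] comp₀ K (taylor f) (dropConst g)) →
           ∀ f → ∂ (comp₁ K F f g) n ≈ ∂ (comp₀ K (taylor f) (dropConst g)) n
    step n ih f = begin
      ∂ (comp₁ K F f g) n                                          ≈⟨ ∂-comp₁ f n ⟩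
      (comp₁ K F (DL K f) g ⊛ ∂ g) n
        ≈⟨ ⊛-cong-≋[] {v = ∂ g} {∂ g} (ih (DL K f)) (λ _ _ → refl) n ℕ.≤-refl ⟩
      (comp₀ K (taylor (DL K f)) (dropConst g) ⊛ ∂ g) n
        ≈⟨ ⊛-congʳ (∂ g) (comp₀-cong (∂-taylor f) 𝓕.refl) n ⟨
      (comp₀ K (∂ (taylor f)) (dropConst g) ⊛ ∂ (dropConst g)) n   ≈⟨ ∂-comp₀ refl (taylor f) n ⟨
      ∂ (comp₀ K (taylor f) (dropConst g)) n                       ∎

  ΦL≈Φ-taylor : ∀ n f y → y 0 ≈ g 0 → ΦL K F n f y ≈ Φ K n (taylor f) y
  ΦL≈Φ-taylor n f y y₀≈g₀ = Σ<-cong (suc n) (λ k _ → *-congʳ (begin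
    evalK K F (DLⁱ K k f) (y 0)
      ≈⟨ evalK-cong (DLⁱ K k f) (g₀≉0 ∘ trans (sym y₀≈g₀)) y₀≈g₀ ⟩
    evalK K F (DLⁱ K k f) (g 0)                       ≈⟨ *-identityʳ _ ⟨
    evalK K F (DLⁱ K k f) (g 0) * 1#                  ≈⟨ *-congˡ (ι!*!⁻¹≈1 k) ⟨
    evalK K F (DLⁱ K k f) (g 0) * (ι K (k !) * k !⁻¹) ≈⟨ x∙yz≈y∙xz _ _ _ ⟨
    ι K (k !) * taylor f k                            ≈⟨ Dⁱ-at-0 k (taylor f) ⟨
    Dⁱ K k (taylor f) 0                               ∎))

  Φ-comp₁ : ∀ f n x → Φ K n (comp₁ K F f g) x ≈ ΦL K F n f (λ j → Φ K j g x)
  Φ-comp₁ f n x = begin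
    Φ K n (comp₁ K F f g) x                        ≈⟨ Φ-cong (comp₁≋comp₀-taylor f) n x ⟩
    Φ K n (comp₀ K (taylor f) (dropConst g)) x     ≈⟨ Φ-comp₀-dropConst (taylor f) g n x ⟩
    Φ K n (taylor f) (λ j → Φ K j g x)
      ≈⟨ ΦL≈Φ-taylor n f _ (trans (+-identityˡ _) (*-identityʳ _)) ⟨
    ΦL K F n f (λ j → Φ K j g x)                   ∎

theorem4p11 : {c ℓ : Level} (K : CommutativeRing c ℓ) (F : IsCharZeroField K) →
    -- 0-case: f ∈ 𝓕, g ∈ 𝓕₀
    ((f g h : PS K) → CommutativeRing._≈_ K (g 0) (CommutativeRing.0# K) →
      (_≈ₛ_ K h (comp₀ K f g) ⇔
        ((n : ℕ) → _≈ₚ_ K (Φ K n h) (_∘•_ K (Φ K n f) (λ j → Φ K j g)))))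
    ×
    -- 1-case: f ∈ 𝕂[x⁻¹, x], g ∈ 𝓕₁
    ((f : Laurent K) (g h : PS K) → ¬ CommutativeRing._≈_ K (g 0) (CommutativeRing.0# K) →
      (_≈ₛ_ K h (comp₁ K F f g) ⇔
        ((n : ℕ) → _≈ₚ_ K (Φ K n h) (_∘•_ K (ΦL K F n f) (λ j → Φ K j g)))))
theorem4p11 K F =
  (λ f g h g₀≈0 → ≋⇔Φ≈ₚ h (comp₀ K f g) _ (Φ-comp₀ f g g₀≈0)) ,
  (λ f g h g₀≉0 → ≋⇔Φ≈ₚ h (comp₁ K F f g) _ (LaurentComposition.Φ-comp₁ K F g g₀≉0 f))
  where open FaaDiBruno K F
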